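{- Let $p$ be a prime and $n\ge1$ an integer. Suppose that $A\subseteq(\mathbb{Z}_p)^n$ satisfies $$ |A|>\Big(\Big(2+\frac{1}{p-1}\Big)^{\frac{p-1}{p}}\Big(2-\frac{1}{p}\Big)\Big)^n. $$ Then $A$ contains $p$ elements $v_1,\dots,v_p$, not necessarily distinct but not all equal, such that $\sum_{i=1}^p v_i=0$. -}

module Defs where

open import Data.Nat using (ℕ; _+_; _*_; _^_; _∸_)
open import Data.Fin using (Fin; toℕ)
open import Data.Vec using (Vec; lookup; tabulate; sum)
open import Data.Nat.Divisibility using (_∣_)

Zpn : ℕ → ℕ → Set
Zpn p n = Vec (Fin p) n

SumsToZero : ∀ {p n} → (Fin p → Zpn p n) → Set
SumsToZero {p} {n} v = (k : Fin n) → p ∣ sum (tabulate (λ i → toℕ (lookup (v i) k)))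

-- The size hypothesis |A| > ((2 + 1/(p-1))^((p-1)/p) (2 - 1/p))^n, raised to
-- the p-th power and cleared of denominators (both sides positive):
-- |A|^p > ((2p-1)^(2p-1) / ((p-1)^(p-1) p^p))^n
-- i.e.  (2p-1)^((2p-1)n) < |A|^p * (p-1)^((p-1)n) * p^(pn)
LargeEnough : ℕ → ℕ → ℕ → Set
LargeEnough p n a =
  Data.Nat._<_ ((2 * p ∸ 1) ^ ((2 * p ∸ 1) * n))
               ((a ^ p) * ((p ∸ 1) ^ ((p ∸ 1) * n)) * (p ^ (p * n)))

module Submission where

-- Proof: the slice rank method with a tensor power trick.  Write p = q + 1 and suppose A has
-- only constant zero sums.  Over ℤ/p, F(x₁,…,x_p) = ∏ₗ ∏_{a=1}^{q} (a − Σᵢ xᵢₗ) is nonzero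
-- exactly when every coordinate sum vanishes, so on A^p it is a diagonal tensor with nonzero
-- diagonal.  Expanding F, every monomial has degree at most nq/p in one of its p variables, so
-- F is a sum of p families of slices indexed by the monomials of degree ≤ nq/p in n variables.
-- A diagonal tensor needs as many slices as its support (Tao: contract one variable at a time
-- against a vector orthogonal to its slices, found by Gaussian elimination), hence
-- |A| ≤ p · binom(n + nq/p, n).  The power A^(pT) ⊆ (ℤ/p)^(pTn) again has only constant zero
-- sums, and bounding the binomial coefficient gives
-- (|A|^p q^(qn) p^(pn))^T ≤ p ((2p − 1)^((2p − 1) n))^T for all T, contradicting the size bound.

open import Defs
open import Data.Nat using (ℕ; _≤_)
open import Data.Nat.Primality using (Prime)
open import Data.Fin using (Fin)
open import Data.List using (List; length)
open import Data.List.Relation.Unary.Unique.Propositional using (Unique)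
open import Data.List.Membership.Propositional using (_∈_)
open import Data.Product using (Σ; ∃; _×_)
open import Relation.Binary.PropositionalEquality using (_≢_)

open import Data.Nat using (_+_)
open import Relation.Binary.PropositionalEquality using (_≡_)

module BigOperators where

  open import Data.Bool using (true; false; if_then_else_)
  open import Data.Fin using (Fin; zero; suc)
  open import Data.Fin.Properties using () renaming (_≟_ to _≟ᶠ_)
  open import Data.List using (List; []; _∷_; [_]; map; _++_; length; concatMap; tabulate; allFin)
  open import Data.List.Properties using (length-tabulate)
  open import Data.Nat using (ℕ; zero; suc; _+_; _*_; _^_; _∸_; _≤_; _≤?_; z≤n; z<s)
  open import Data.Nat.Properties
  open import Data.Fin.Properties using (any?)
  open import Data.Product using (∃-syntax; _,_)
  import Data.Vec as Vec
  open import Data.Vec.Functional using () renaming (_∷_ to _◂_)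
  open import Function using (_∘_)
  open import Relation.Nullary using (Dec; yes; no; does; ¬_; contradiction)
  open import Relation.Nullary.Decidable using (dec-true; dec-false)
  open import Relation.Binary.PropositionalEquality hiding ([_])
  open import Algebra.Properties.CommutativeSemigroup +-commutativeSemigroup using () renaming (interchange to +-interchange)
  open import Algebra.Properties.CommutativeSemigroup *-commutativeSemigroup using () renaming (interchange to *-interchange; x∙yz≈y∙xz to *-left-comm)

  ∑ : {A : Set} → List A → (A → ℕ) → ℕ
  ∑ []       f = 0
  ∑ (x ∷ xs) f = f x + ∑ xs f

  ∏ : {A : Set} → List A → (A → ℕ) → ℕ
  ∏ []       f = 1
  ∏ (x ∷ xs) f = f x * ∏ xs f

  ∑< ∏< : (n : ℕ) → (Fin n → ℕ) → ℕ
  ∑< n = ∑ (allFin n)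
  ∏< n = ∏ (allFin n)

  infix 1 ∑ ∏ ∑< ∏<
  syntax ∑ xs (λ x → e) = ∑[ x ∈ xs ] e
  syntax ∏ xs (λ x → e) = ∏[ x ∈ xs ] e
  syntax ∑< n (λ i → e) = ∑[ i < n ] e
  syntax ∏< n (λ i → e) = ∏[ i < n ] e

  𝟙 : {P : Set} → Dec P → ℕ
  𝟙 d = if does d then 1 else 0

  𝟙-yes : {P : Set} (d : Dec P) → P → 𝟙 d ≡ 1
  𝟙-yes d x = cong (λ b → if b then 1 else 0) (dec-true d x)

  𝟙-no : {P : Set} (d : Dec P) → ¬ P → 𝟙 d ≡ 0
  𝟙-no d ¬x = cong (λ b → if b then 1 else 0) (dec-false d ¬x)

  module _ {A : Set} where

    ∑-cong : ∀ (xs : List A) {f g : A → ℕ} → (∀ x → f x ≡ g x) → ∑ xs f ≡ ∑ xs g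
    ∑-cong []       f≗g = refl
    ∑-cong (x ∷ xs) f≗g = cong₂ _+_ (f≗g x) (∑-cong xs f≗g)

    ∏-cong : ∀ (xs : List A) {f g : A → ℕ} → (∀ x → f x ≡ g x) → ∏ xs f ≡ ∏ xs g
    ∏-cong []       f≗g = refl
    ∏-cong (x ∷ xs) f≗g = cong₂ _*_ (f≗g x) (∏-cong xs f≗g)

    ∑-distrib-+ : ∀ (xs : List A) (f g : A → ℕ) → (∑[ x ∈ xs ] f x + g x) ≡ ∑ xs f + ∑ xs g
    ∑-distrib-+ []       f g = refl
    ∑-distrib-+ (x ∷ xs) f g =
      trans (cong (f x + g x +_) (∑-distrib-+ xs f g)) (+-interchange (f x) (g x) _ _)

    ∏-distrib-* : ∀ (xs : List A) (f g : A → ℕ) → (∏[ x ∈ xs ] f x * g x) ≡ ∏ xs f * ∏ xs g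
    ∏-distrib-* []       f g = refl
    ∏-distrib-* (x ∷ xs) f g =
      trans (cong (f x * g x *_) (∏-distrib-* xs f g)) (*-interchange (f x) (g x) _ _)

    *-distribˡ-∑ : ∀ (xs : List A) k (f : A → ℕ) → k * ∑ xs f ≡ (∑[ x ∈ xs ] k * f x)
    *-distribˡ-∑ []       k f = *-zeroʳ k
    *-distribˡ-∑ (x ∷ xs) k f = trans (*-distribˡ-+ k (f x) _) (cong (k * f x +_) (*-distribˡ-∑ xs k f))

    *-distribʳ-∑ : ∀ (xs : List A) k (f : A → ℕ) → ∑ xs f * k ≡ (∑[ x ∈ xs ] f x * k)
    *-distribʳ-∑ xs k f = trans (*-comm _ k) (trans (*-distribˡ-∑ xs k f) (∑-cong xs (λ x → *-comm k (f x))))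

    ∑-zero : ∀ (xs : List A) {f : A → ℕ} → (∀ x → f x ≡ 0) → ∑ xs f ≡ 0
    ∑-zero []       f≗0 = refl
    ∑-zero (x ∷ xs) f≗0 = cong₂ _+_ (f≗0 x) (∑-zero xs f≗0)

    ∏-one : ∀ (xs : List A) {f : A → ℕ} → (∀ x → f x ≡ 1) → ∏ xs f ≡ 1
    ∏-one []       f≗1 = refl
    ∏-one (x ∷ xs) f≗1 = cong₂ _*_ (f≗1 x) (∏-one xs f≗1)

    ∑-const : ∀ (xs : List A) k → (∑[ x ∈ xs ] k) ≡ length xs * k
    ∑-const []       k = refl
    ∑-const (x ∷ xs) k = cong (k +_) (∑-const xs k)

    ∑-mono-≤ : ∀ (xs : List A) {f g : A → ℕ} → (∀ x → f x ≤ g x) → ∑ xs f ≤ ∑ xs g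
    ∑-mono-≤ []       f≤g = z≤n
    ∑-mono-≤ (x ∷ xs) f≤g = +-mono-≤ (f≤g x) (∑-mono-≤ xs f≤g)

    ∑-++ : ∀ (xs ys : List A) (f : A → ℕ) → ∑ (xs ++ ys) f ≡ ∑ xs f + ∑ ys f
    ∑-++ []       ys f = refl
    ∑-++ (x ∷ xs) ys f = trans (cong (f x +_) (∑-++ xs ys f)) (sym (+-assoc (f x) _ _))

    ∏-^ : ∀ (xs : List A) b (f : A → ℕ) → (∏[ x ∈ xs ] b ^ f x) ≡ b ^ ∑ xs f
    ∏-^ []       b f = refl
    ∏-^ (x ∷ xs) b f = trans (cong (b ^ f x *_) (∏-^ xs b f)) (sym (^-distribˡ-+-* b (f x) _))

  module _ {A B : Set} where

    ∑-map : ∀ (g : A → B) (xs : List A) (f : B → ℕ) → ∑ (map g xs) f ≡ ∑ xs (f ∘ g)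
    ∑-map g []       f = refl
    ∑-map g (x ∷ xs) f = cong (f (g x) +_) (∑-map g xs f)

    ∑-concatMap : ∀ (g : A → List B) (xs : List A) (f : B → ℕ) →
                  ∑ (concatMap g xs) f ≡ (∑[ x ∈ xs ] ∑ (g x) f)
    ∑-concatMap g []       f = refl
    ∑-concatMap g (x ∷ xs) f = trans (∑-++ (g x) _ f) (cong (∑ (g x) f +_) (∑-concatMap g xs f))

    ∑-comm : ∀ (xs : List A) (ys : List B) (f : A → B → ℕ) →
             (∑[ x ∈ xs ] ∑[ y ∈ ys ] f x y) ≡ (∑[ y ∈ ys ] ∑[ x ∈ xs ] f x y)
    ∑-comm []       ys f = sym (∑-zero ys (λ _ → refl))
    ∑-comm (x ∷ xs) ys f = trans (cong (∑ ys (f x) +_) (∑-comm xs ys f)) (sym (∑-distrib-+ ys (f x) _))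

    ∏-comm : ∀ (xs : List A) (ys : List B) (f : A → B → ℕ) →
             (∏[ x ∈ xs ] ∏[ y ∈ ys ] f x y) ≡ (∏[ y ∈ ys ] ∏[ x ∈ xs ] f x y)
    ∏-comm []       ys f = sym (∏-one ys (λ _ → refl))
    ∏-comm (x ∷ xs) ys f = trans (cong (∏ ys (f x) *_) (∏-comm xs ys f)) (sym (∏-distrib-* ys (f x) _))

    ∑-*-comm : ∀ (xs : List A) (ys : List B) (h : A → ℕ) (F : B → A → ℕ) →
               (∑[ x ∈ xs ] h x * (∑[ y ∈ ys ] F y x)) ≡ (∑[ y ∈ ys ] ∑[ x ∈ xs ] h x * F y x)
    ∑-*-comm xs ys h F = trans (∑-cong xs (λ x → *-distribˡ-∑ ys (h x) (λ y → F y x))) (∑-comm xs ys _)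

    ∑-*-interchange : ∀ (xs : List A) (ys : List B) (h : A → ℕ) (a : B → ℕ) (b : B → A → ℕ) →
                      (∑[ x ∈ xs ] h x * (∑[ y ∈ ys ] a y * b y x)) ≡ (∑[ y ∈ ys ] a y * (∑[ x ∈ xs ] h x * b y x))
    ∑-*-interchange xs ys h a b = begin
      (∑[ x ∈ xs ] h x * (∑[ y ∈ ys ] a y * b y x))   ≡⟨ ∑-*-comm xs ys h (λ y x → a y * b y x) ⟩
      (∑[ y ∈ ys ] ∑[ x ∈ xs ] h x * (a y * b y x))   ≡⟨ ∑-cong ys (λ y → ∑-cong xs (λ x → *-left-comm (h x) (a y) (b y x))) ⟩
      (∑[ y ∈ ys ] ∑[ x ∈ xs ] a y * (h x * b y x))   ≡⟨ ∑-cong ys (λ y → *-distribˡ-∑ xs (a y) _) ⟨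
      (∑[ y ∈ ys ] a y * (∑[ x ∈ xs ] h x * b y x))   ∎
      where open ≡-Reasoning

  ∑-tabulate : ∀ {A : Set} n (g : Fin n → A) (f : A → ℕ) → ∑ (tabulate g) f ≡ ∑< n (f ∘ g)
  ∑-tabulate zero    g f = refl
  ∑-tabulate (suc n) g f =
    cong (f (g zero) +_) (trans (∑-tabulate n (g ∘ suc) f) (sym (∑-tabulate n suc (f ∘ g))))

  ∏-tabulate : ∀ {A : Set} n (g : Fin n → A) (f : A → ℕ) → ∏ (tabulate g) f ≡ ∏< n (f ∘ g)
  ∏-tabulate zero    g f = refl
  ∏-tabulate (suc n) g f =
    cong (f (g zero) *_) (trans (∏-tabulate n (g ∘ suc) f) (sym (∏-tabulate n suc (f ∘ g))))

  ∑<-suc : ∀ n (f : Fin (suc n) → ℕ) → ∑< (suc n) f ≡ f zero + ∑< n (f ∘ suc)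
  ∑<-suc n f = cong (f zero +_) (∑-tabulate n suc f)

  ∏<-suc : ∀ n (f : Fin (suc n) → ℕ) → ∏< (suc n) f ≡ f zero * ∏< n (f ∘ suc)
  ∏<-suc n f = cong (f zero *_) (∏-tabulate n suc f)

  ∑<-const : ∀ n k → (∑[ i < n ] k) ≡ n * k
  ∑<-const n k = trans (∑-const (allFin n) k) (cong (_* k) (length-tabulate {n = n} (λ i → i)))

  ∑<-𝟙 : ∀ n (j : Fin n) (f : Fin n → ℕ) → (∑[ i < n ] 𝟙 (j ≟ᶠ i) * f i) ≡ f j
  ∑<-𝟙 (suc n) zero f = begin
    (∑[ i < suc n ] 𝟙 (zero ≟ᶠ i) * f i) ≡⟨ ∑<-suc n (λ i → 𝟙 (zero ≟ᶠ i) * f i) ⟩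
    f zero + 0 + ∑< n (λ _ → 0)          ≡⟨ cong (f zero + 0 +_) (∑-zero (allFin n) (λ _ → refl)) ⟩
    f zero + 0 + 0                       ≡⟨ trans (+-identityʳ _) (+-identityʳ _) ⟩
    f zero                               ∎
    where open ≡-Reasoning
  ∑<-𝟙 (suc n) (suc j) f = trans (∑<-suc n (λ i → 𝟙 (suc j ≟ᶠ i) * f i)) (∑<-𝟙 n j (f ∘ suc))

  ∏<-𝟙 : ∀ n (j : Fin n) (f : Fin n → ℕ) → (∏[ i < n ] f i ^ 𝟙 (j ≟ᶠ i)) ≡ f j
  ∏<-𝟙 (suc n) zero f = begin
    (∏[ i < suc n ] f i ^ 𝟙 (zero ≟ᶠ i)) ≡⟨ ∏<-suc n (λ i → f i ^ 𝟙 (zero ≟ᶠ i)) ⟩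
    f zero * 1 * ∏< n (λ _ → 1)          ≡⟨ cong (f zero * 1 *_) (∏-one (allFin n) (λ _ → refl)) ⟩
    f zero * 1 * 1                       ≡⟨ trans (*-identityʳ _) (*-identityʳ _) ⟩
    f zero                               ∎
    where open ≡-Reasoning
  ∏<-𝟙 (suc n) (suc j) f = trans (∏<-suc n (λ i → f i ^ 𝟙 (suc j ≟ᶠ i))) (trans (*-identityˡ _) (∏<-𝟙 n j (f ∘ suc)))

  ∏<-except : ∀ n (j : Fin n) (f : Fin n → ℕ) → f j * (∏[ i < n ] f i ^ (1 ∸ 𝟙 (j ≟ᶠ i))) ≡ ∏< n f
  ∏<-except n j f = begin
    f j * (∏[ i < n ] f i ^ (1 ∸ 𝟙 (j ≟ᶠ i)))                           ≡⟨ cong (_* (∏[ i < n ] f i ^ (1 ∸ 𝟙 (j ≟ᶠ i)))) (∏<-𝟙 n j f) ⟨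
    (∏[ i < n ] f i ^ 𝟙 (j ≟ᶠ i)) * (∏[ i < n ] f i ^ (1 ∸ 𝟙 (j ≟ᶠ i))) ≡⟨ ∏-distrib-* (allFin n) _ _ ⟨
    (∏[ i < n ] f i ^ 𝟙 (j ≟ᶠ i) * f i ^ (1 ∸ 𝟙 (j ≟ᶠ i)))              ≡⟨ ∏-cong (allFin n) split ⟩
    ∏< n f                                                               ∎
    where
    open ≡-Reasoning
    split : ∀ i → f i ^ 𝟙 (j ≟ᶠ i) * f i ^ (1 ∸ 𝟙 (j ≟ᶠ i)) ≡ f i
    split i with does (j ≟ᶠ i)
    ... | true  = trans (*-identityʳ _) (*-identityʳ _)
    ... | false = trans (*-identityˡ _) (*-identityʳ _)

  sum-tabulate : ∀ n (f : Fin n → ℕ) → Vec.sum (Vec.tabulate f) ≡ ∑< n f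
  sum-tabulate zero    f = refl
  sum-tabulate (suc n) f = trans (cong (f zero +_) (sum-tabulate n (f ∘ suc))) (sym (∑<-suc n f))

  ∃-≤-average : ∀ n (a : Fin (suc n) → ℕ) M → ∑< (suc n) a ≤ M → ∃[ i ] suc n * a i ≤ M
  ∃-≤-average n a M ∑a≤M with any? (λ i → suc n * a i ≤? M)
  ... | yes found = found
  ... | no  none  = contradiction (*-monoʳ-≤ (suc n) ∑a≤M) (<⇒≱ (begin-strict
    suc n * M                       <⟨ m<m+n (suc n * M) z<s ⟩
    suc n * M + suc n               ≡⟨ trans (+-comm _ (suc n)) (sym (*-suc (suc n) M)) ⟩
    suc n * suc M                   ≡⟨ ∑<-const (suc n) (suc M) ⟨
    (∑[ i < suc n ] suc M)          ≤⟨ ∑-mono-≤ (allFin (suc n)) (λ i → ≰⇒> (λ le → none (i , le))) ⟩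
    (∑[ i < suc n ] suc n * a i)    ≡⟨ *-distribˡ-∑ (allFin (suc n)) (suc n) a ⟨
    suc n * ∑< (suc n) a            ∎))
    where open ≤-Reasoning

  allFunctions : ∀ {A : Set} n → List A → List (Fin n → A)
  allFunctions zero    M = [ (λ ()) ]
  allFunctions (suc n) M = concatMap (λ a → map (a ◂_) (allFunctions n M)) M

  ∏-∑-distrib : ∀ {A : Set} n (M : List A) (t : Fin n → A → ℕ) →
                (∏[ u < n ] ∑ M (t u)) ≡ (∑[ C ∈ allFunctions n M ] ∏[ u < n ] t u (C u))
  ∏-∑-distrib zero    M t = refl
  ∏-∑-distrib (suc n) M t = begin
    (∏[ u < suc n ] ∑ M (t u))                                          ≡⟨ ∏<-suc n (λ u → ∑ M (t u)) ⟩
    ∑ M (t zero) * (∏[ u < n ] ∑ M (t (suc u)))                         ≡⟨ cong (∑ M (t zero) *_) (∏-∑-distrib n M (t ∘ suc)) ⟩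
    ∑ M (t zero) * (∑[ C ∈ allFunctions n M ] ∏[ u < n ] t (suc u) (C u))  ≡⟨ *-distribʳ-∑ M _ (t zero) ⟩
    (∑[ a ∈ M ] t zero a * (∑[ C ∈ allFunctions n M ] ∏[ u < n ] t (suc u) (C u)))
                                                                       ≡⟨ ∑-cong M (λ a → *-distribˡ-∑ (allFunctions n M) (t zero a) _) ⟩
    (∑[ a ∈ M ] ∑[ C ∈ allFunctions n M ] t zero a * (∏[ u < n ] t (suc u) (C u)))
                                                                       ≡⟨ ∑-cong M (λ a → ∑-cong (allFunctions n M) (λ C → ∏<-suc n (λ u → t u ((a ◂ C) u)))) ⟨
    (∑[ a ∈ M ] ∑[ C ∈ allFunctions n M ] ∏[ u < suc n ] t u ((a ◂ C) u)) ≡⟨ ∑-cong M (λ a → ∑-map (a ◂_) (allFunctions n M) _) ⟨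
    (∑[ a ∈ M ] ∑[ C ∈ map (a ◂_) (allFunctions n M) ] ∏[ u < suc n ] t u (C u))
                                                                       ≡⟨ ∑-concatMap (λ a → map (a ◂_) (allFunctions n M)) M _ ⟨
    (∑[ C ∈ allFunctions (suc n) M ] ∏[ u < suc n ] t u (C u))             ∎
    where open ≡-Reasoning

module Congruence (p : ℕ) (prime : Prime p) where

  open import Data.List using (List; []; _∷_)
  open import Data.List.Relation.Unary.All using (All; []; _∷_)
  open import Data.List.Relation.Unary.Any using (here; there)
  open import Data.List.Membership.Propositional using (_∈_)
  open import Data.Nat using (ℕ; suc; _+_; _*_; _<_; s≤s; z≤n; NonZero; nonTrivial⇒n>1)
  open import Data.Nat.DivMod using (_%_; %-distribˡ-+; %-distribˡ-*; m*n%n≡0; m<n⇒m%n≡m)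
  open import Data.Nat.Divisibility using (_∣_; m%n≡0⇒n∣m; n∣m⇒m%n≡0; ∣m⇒∣m*n; ∣n⇒∣m*n; m∣m*n; _∣?_)
  open import Data.Nat.Primality using (prime⇒nonZero; prime⇒nonTrivial; euclidsLemma)
  open import Data.Nat.Properties using (+-identityʳ)
  open import Data.Sum using (inj₁; inj₂)
  open import Level using (0ℓ)
  open import Relation.Binary.Bundles using (Setoid)
  import Relation.Binary.Reasoning.Setoid as SetoidReasoning
  open import Relation.Binary.Structures using (IsEquivalence)
  open import Relation.Nullary using (Dec; yes; no; ¬_)
  open import Relation.Binary.PropositionalEquality as ≡ using (_≡_; refl; cong₂)

  open BigOperators

  instance
    p≢0 : NonZero p
    p≢0 = prime⇒nonZero prime

  infix 4 _≈_ _≉_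

  -- Congruence modulo p, wrapped in a record so that both sides can be inferred by unification.
  record _≈_ (a b : ℕ) : Set where
    constructor mod-≡
    field %-≡ : a % p ≡ b % p

  _≉_ : ℕ → ℕ → Set
  a ≉ b = ¬ a ≈ b

  ≈-isEquivalence : IsEquivalence _≈_
  ≈-isEquivalence = record
    { refl  = mod-≡ refl
    ; sym   = λ (mod-≡ e) → mod-≡ (≡.sym e)
    ; trans = λ (mod-≡ e) (mod-≡ f) → mod-≡ (≡.trans e f)
    }

  ≈-setoid : Setoid 0ℓ 0ℓ
  ≈-setoid = record { isEquivalence = ≈-isEquivalence }

  open IsEquivalence ≈-isEquivalence public
    using () renaming (refl to ≈-refl; sym to ≈-sym; trans to ≈-trans; reflexive to ≡⇒≈)

  module ≈-Reasoning = SetoidReasoning ≈-setoid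

  +-cong : ∀ {a b c d} → a ≈ b → c ≈ d → a + c ≈ b + d
  +-cong {a} {b} {c} {d} (mod-≡ a≈b) (mod-≡ c≈d) = mod-≡ (begin
    (a + c) % p           ≡⟨ %-distribˡ-+ a c p ⟩
    (a % p + c % p) % p   ≡⟨ cong₂ (λ x y → (x + y) % p) a≈b c≈d ⟩
    (b % p + d % p) % p   ≡⟨ %-distribˡ-+ b d p ⟨
    (b + d) % p           ∎)
    where open ≡.≡-Reasoning

  *-cong : ∀ {a b c d} → a ≈ b → c ≈ d → a * c ≈ b * d
  *-cong {a} {b} {c} {d} (mod-≡ a≈b) (mod-≡ c≈d) = mod-≡ (begin
    (a * c) % p             ≡⟨ %-distribˡ-* a c p ⟩
    (a % p * (c % p)) % p   ≡⟨ cong₂ (λ x y → (x * y) % p) a≈b c≈d ⟩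
    (b % p * (d % p)) % p   ≡⟨ %-distribˡ-* b d p ⟨
    (b * d) % p             ∎)
    where open ≡.≡-Reasoning

  +-congʳ : ∀ {a b} c → a ≈ b → a + c ≈ b + c
  +-congʳ c a≈b = +-cong a≈b (≈-refl {c})

  *-congˡ : ∀ a {b c} → b ≈ c → a * b ≈ a * c
  *-congˡ a = *-cong (≈-refl {a})

  ∑-cong-≈ : ∀ {A : Set} (xs : List A) {f g : A → ℕ} → (∀ x → f x ≈ g x) → ∑ xs f ≈ ∑ xs g
  ∑-cong-≈ []       f≈g = ≈-refl
  ∑-cong-≈ (x ∷ xs) f≈g = +-cong (f≈g x) (∑-cong-≈ xs f≈g)

  ∣⇒≈0 : ∀ {a} → p ∣ a → a ≈ 0
  ∣⇒≈0 {a} p∣a = mod-≡ (≡.trans (n∣m⇒m%n≡0 a p p∣a) (≡.sym (m*n%n≡0 0 p)))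

  ≈0⇒∣ : ∀ {a} → a ≈ 0 → p ∣ a
  ≈0⇒∣ {a} (mod-≡ a≈0) = m%n≡0⇒n∣m a p (≡.trans a≈0 (m*n%n≡0 0 p))

  _≈0? : ∀ a → Dec (a ≈ 0)
  a ≈0? with p ∣? a
  ... | yes p∣a = yes (∣⇒≈0 p∣a)
  ... | no p∤a  = no (λ a≈0 → p∤a (≈0⇒∣ a≈0))

  p*-≈0 : ∀ k → p * k ≈ 0
  p*-≈0 k = ∣⇒≈0 (m∣m*n k)

  *-≈0ˡ : ∀ {a} b → a ≈ 0 → a * b ≈ 0
  *-≈0ˡ b a≈0 = ∣⇒≈0 (∣m⇒∣m*n b (≈0⇒∣ a≈0))

  *-≈0ʳ : ∀ a {b} → b ≈ 0 → a * b ≈ 0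
  *-≈0ʳ a b≈0 = ∣⇒≈0 (∣n⇒∣m*n a (≈0⇒∣ b≈0))

  +-≈0 : ∀ a {b} → b ≈ 0 → a + b ≈ a
  +-≈0 a b≈0 = ≈-trans (+-cong ≈-refl b≈0) (≡⇒≈ (+-identityʳ a))

  ∑-≈0 : ∀ {A : Set} {xs : List A} {f : A → ℕ} → All (λ x → f x ≈ 0) xs → ∑ xs f ≈ 0
  ∑-≈0 []            = ≈-refl
  ∑-≈0 (fx≈0 ∷ f≈0s) = ≈-trans (+-cong fx≈0 (∑-≈0 f≈0s)) ≈-refl

  ∏-≈0 : ∀ {A : Set} {xs : List A} (f : A → ℕ) {x} → x ∈ xs → f x ≈ 0 → ∏ xs f ≈ 0
  ∏-≈0 f (here refl) fx≈0 = *-≈0ˡ _ fx≈0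
  ∏-≈0 {xs = y ∷ _} f (there x∈xs) fx≈0 = *-≈0ʳ (f y) (∏-≈0 f x∈xs fx≈0)

  0<n<p⇒≉0 : ∀ {a} → 0 < a → a < p → a ≉ 0
  0<n<p⇒≉0 {suc a} _ a<p (mod-≡ a≈0) with ≡.trans (≡.sym (m<n⇒m%n≡m a<p)) (≡.trans a≈0 (m*n%n≡0 0 p))
  ... | ()

  1≉0 : 1 ≉ 0
  1≉0 = 0<n<p⇒≉0 (s≤s z≤n) (nonTrivial⇒n>1 p {{prime⇒nonTrivial prime}})

  𝟙-*-≈0 : ∀ {P : Set} (d : Dec P) {a} → (P → a ≈ 0) → 𝟙 d * a ≈ 0
  𝟙-*-≈0 (yes x) a≈0 = ≈-trans (≡⇒≈ (+-identityʳ _)) (a≈0 x)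
  𝟙-*-≈0 (no _)  a≈0 = ≈-refl

  *-≉0 : ∀ {a b} → a ≉ 0 → b ≉ 0 → a * b ≉ 0
  *-≉0 {a} {b} a≉0 b≉0 ab≈0 with euclidsLemma a b prime (≈0⇒∣ ab≈0)
  ... | inj₁ p∣a = a≉0 (∣⇒≈0 p∣a)
  ... | inj₂ p∣b = b≉0 (∣⇒≈0 p∣b)

  ∏-≉0 : ∀ {A : Set} (xs : List A) {f : A → ℕ} → (∀ x → f x ≉ 0) → ∏ xs f ≉ 0
  ∏-≉0 []       f≉0 = 1≉0
  ∏-≉0 (x ∷ xs) f≉0 = *-≉0 (f≉0 x) (∏-≉0 xs f≉0)

module Orthogonality (p : ℕ) (prime : Prime p) (N : ℕ) where

  open import Data.Bool using (true; not)
  open import Data.Empty using (⊥-elim)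
  open import Data.Fin using (Fin; zero; suc)
  open import Data.Fin.Properties using (any?) renaming (_≟_ to _≟ᶠ_)
  open import Data.Fin.Subset using (Subset; _∉_; _⊆_; _-_; ⁅_⁆; ∣_∣; ⊤; inside; outside) renaming (_∈_ to _∈ₛ_)
  open import Data.Fin.Subset.Properties using (_∈?_; p─q⊆p; p⊆q⇒∣p∣≤∣q∣; p─⊥≡p; Empty-unique; ∣⊥∣≡0; ∣⊤∣≡n; ∣p∣≤n)
  open import Data.List using (List; []; _∷_; length; allFin)
  open import Data.List.Relation.Unary.All as All using (All; []; _∷_)
  open import Data.Nat using (ℕ; suc; pred; _+_; _*_; _≤_; s≤s)
  open import Data.Nat.Properties
  open import Data.Product using (∃-syntax; _×_; _,_)
  open import Data.Vec using (_∷_; tabulate; there)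
  open import Data.Vec.Properties using (lookup∘tabulate; []=⇒lookup; lookup⇒[]=)
  open import Relation.Binary.PropositionalEquality
  open import Data.Nat.Tactic.RingSolver using (solve-∀)
  open import Relation.Nullary using (yes; no; does; ¬?)
  open import Relation.Nullary.Decidable using (_×-dec_)

  open BigOperators
  open Congruence p prime

  infix 7 _·_

  _·_ : (Fin N → ℕ) → (Fin N → ℕ) → ℕ
  u · v = ∑[ j < N ] u j * v j

  _⊙_ : (Fin N → ℕ) → (Fin N → ℕ) → Fin N → ℕ
  (u ⊙ v) j = u j * v j

  ·-linear : ∀ a b (u v φ : Fin N → ℕ) → (λ j → a * u j + b * v j) · φ ≡ a * (u · φ) + b * (v · φ)
  ·-linear a b u v φ = begin
    (∑[ j < N ] (a * u j + b * v j) * φ j)                          ≡⟨ ∑-cong (allFin N) distrib ⟩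
    (∑[ j < N ] a * (u j * φ j) + b * (v j * φ j))                  ≡⟨ ∑-distrib-+ (allFin N) _ _ ⟩
    (∑[ j < N ] a * (u j * φ j)) + (∑[ j < N ] b * (v j * φ j))     ≡⟨ cong₂ _+_ (*-distribˡ-∑ (allFin N) a _) (*-distribˡ-∑ (allFin N) b _) ⟨
    a * (u · φ) + b * (v · φ)                                       ∎
    where
    open ≡-Reasoning
    distrib : ∀ j → (a * u j + b * v j) * φ j ≡ a * (u j * φ j) + b * (v j * φ j)
    distrib j = trans (*-distribʳ-+ (φ j) (a * u j) (b * v j)) (cong₂ _+_ (*-assoc a _ _) (*-assoc b _ _))

  ·-∑ : ∀ (a : Fin N → ℕ) (u : Fin N → Fin N → ℕ) φ →
        (λ y → ∑[ x < N ] a x * u x y) · φ ≡ (∑[ x < N ] a x * (u x · φ))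
  ·-∑ a u φ = begin
    (∑[ y < N ] (∑[ x < N ] a x * u x y) * φ y)   ≡⟨ ∑-cong (allFin N) (λ y → *-distribʳ-∑ (allFin N) (φ y) _) ⟩
    (∑[ y < N ] ∑[ x < N ] a x * u x y * φ y)     ≡⟨ ∑-comm (allFin N) (allFin N) _ ⟩
    (∑[ x < N ] ∑[ y < N ] a x * u x y * φ y)     ≡⟨ ∑-cong (allFin N) (λ x → ∑-cong (allFin N) (λ y → *-assoc (a x) _ _)) ⟩
    (∑[ x < N ] ∑[ y < N ] a x * (u x y * φ y))   ≡⟨ ∑-cong (allFin N) (λ x → *-distribˡ-∑ (allFin N) (a x) _) ⟨
    (∑[ x < N ] a x * (u x · φ))                  ∎
    where open ≡-Reasoning

  support : (Fin N → ℕ) → Subset N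
  support c = tabulate (λ j → not (does (c j ≈0?)))

  ∈-support⁻ : ∀ {c j} → j ∈ₛ support c → c j ≉ 0
  ∈-support⁻ {c} {j} j∈c with c j ≈0? | trans (sym ([]=⇒lookup j∈c)) (lookup∘tabulate (λ j → not (does (c j ≈0?))) j)
  ... | no c≉0 | _  = c≉0

  ∈-support⁺ : ∀ {c j} → c j ≉ 0 → j ∈ₛ support c
  ∈-support⁺ {c} {j} c≉0 = lookup⇒[]= j (support c) (trans (lookup∘tabulate _ j) not-zero)
    where
    not-zero : not (does (c j ≈0?)) ≡ true
    not-zero with c j ≈0?
    ... | yes c≈0 = ⊥-elim (c≉0 c≈0)
    ... | no _    = refl

  ∣support∣≡0 : ∀ {c} → (∀ j → c j ≈ 0) → ∣ support c ∣ ≡ 0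
  ∣support∣≡0 {c} c≈0 = trans (cong ∣_∣ (Empty-unique {p = support c} (λ (j , j∈c) → ∈-support⁻ j∈c (c≈0 j)))) (∣⊥∣≡0 N)

  ∣support∣≡N : ∀ {c} → (∀ j → c j ≉ 0) → ∣ support c ∣ ≡ N
  ∣support∣≡N {c} c≉0 = ≤-antisym (∣p∣≤n (support c))
    (≤-trans (≤-reflexive (sym (∣⊤∣≡n N))) (p⊆q⇒∣p∣≤∣q∣ {p = ⊤} (λ {j} _ → ∈-support⁺ (c≉0 j))))

  x∉p-x : ∀ {n} (P : Subset n) x → x ∉ P - x
  x∉p-x (_ ∷ P) zero    ()
  x∉p-x (_ ∷ P) (suc x) (there x∈P-x) = x∉p-x P x x∈P-x

  ∣p∣≤1+∣p-x∣ : ∀ {n} (P : Subset n) x → ∣ P ∣ ≤ suc ∣ P - x ∣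
  ∣p∣≤1+∣p-x∣ (outside ∷ P) zero    = ≤-trans (≤-reflexive (cong ∣_∣ (sym (p─⊥≡p P)))) (n≤1+n _)
  ∣p∣≤1+∣p-x∣ (inside  ∷ P) zero    = s≤s (≤-reflexive (cong ∣_∣ (sym (p─⊥≡p P))))
  ∣p∣≤1+∣p-x∣ (outside ∷ P) (suc x) = ∣p∣≤1+∣p-x∣ P x
  ∣p∣≤1+∣p-x∣ (inside  ∷ P) (suc x) = s≤s (∣p∣≤1+∣p-x∣ P x)

  record DiagonalFamily (Φ : List (Fin N → ℕ)) (c : Fin N → ℕ) : Set where
    field
      pivots         : Subset N
      row            : Fin N → Fin N → ℕ
      pivots⊆support : pivots ⊆ support c
      row-pivot      : ∀ {x} → x ∈ₛ pivots → row x x ≉ 0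
      row-off-pivot  : ∀ {x y} → x ∈ₛ pivots → y ∈ₛ pivots → x ≢ y → row x y ≈ 0
      row-⊥          : ∀ {x} → x ∈ₛ pivots → All (λ φ → row x · φ ≈ 0) Φ
      support-bound  : ∣ support c ∣ ≤ length Φ + ∣ pivots ∣

  diagonalFamily-[] : ∀ c → DiagonalFamily [] c
  diagonalFamily-[] c = record
    { pivots         = support c
    ; row            = λ x y → 𝟙 (x ≟ᶠ y)
    ; pivots⊆support = λ x∈c → x∈c
    ; row-pivot      = λ {x} _ → subst (_≉ 0) (sym (𝟙-yes (x ≟ᶠ x) refl)) 1≉0
    ; row-off-pivot  = λ {x} {y} _ _ x≢y → ≡⇒≈ (𝟙-no (x ≟ᶠ y) x≢y)
    ; row-⊥          = λ _ → []
    ; support-bound  = ≤-refl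
    }

  module _ {Φ c} (D : DiagonalFamily Φ c) (φ : Fin N → ℕ) where
    open DiagonalFamily D

    diagonalFamily-keep : (∀ {x} → x ∈ₛ pivots → row x · φ ≈ 0) → DiagonalFamily (φ ∷ Φ) c
    diagonalFamily-keep row⊥φ = record
      { pivots         = pivots
      ; row            = row
      ; pivots⊆support = pivots⊆support
      ; row-pivot      = row-pivot
      ; row-off-pivot  = row-off-pivot
      ; row-⊥          = λ x∈F → row⊥φ x∈F ∷ row-⊥ x∈F
      ; support-bound  = ≤-trans support-bound (+-monoˡ-≤ ∣ pivots ∣ (n≤1+n (length Φ)))
      }

    -- One step of Gaussian elimination with pivot x₀, using pred p as -1.
    diagonalFamily-eliminate : ∀ {x₀} → x₀ ∈ₛ pivots → row x₀ · φ ≉ 0 → DiagonalFamily (φ ∷ Φ) c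
    diagonalFamily-eliminate {x₀} x₀∈F λ≉0 = record
      { pivots         = pivots - x₀
      ; row            = row′
      ; pivots⊆support = λ x∈F′ → pivots⊆support (∈F x∈F′)
      ; row-pivot      = row′-pivot
      ; row-off-pivot  = row′-off-pivot
      ; row-⊥          = λ x∈F′ → row′-⊥φ _ ∷ All.zipWith combine⊥ (row-⊥ (∈F x∈F′) , row-⊥ x₀∈F)
      ; support-bound  = ≤-trans support-bound
                           (≤-trans (+-monoʳ-≤ (length Φ) (∣p∣≤1+∣p-x∣ pivots x₀)) (≤-reflexive (+-suc _ _)))
      }
      where
      λ₀ = row x₀ · φ

      μ : Fin N → ℕ
      μ x = pred p * (row x · φ)

      row′ : Fin N → Fin N → ℕ
      row′ x y = λ₀ * row x y + μ x * row x₀ y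

      ∈F : ∀ {x} → x ∈ₛ pivots - x₀ → x ∈ₛ pivots
      ∈F {x} x∈F′ = p─q⊆p pivots ⁅ x₀ ⁆ x∈F′

      ≢x₀ : ∀ {x} → x ∈ₛ pivots - x₀ → x₀ ≢ x
      ≢x₀ {x} x∈F′ refl = x∉p-x pivots x₀ x∈F′

      combine⊥ : ∀ {x ψ} → row x · ψ ≈ 0 × row x₀ · ψ ≈ 0 → row′ x · ψ ≈ 0
      combine⊥ {x} {ψ} (r≈0 , r₀≈0) = ≈-trans (≡⇒≈ (·-linear λ₀ (μ x) (row x) (row x₀) ψ))
                                       (≈-trans (+-cong (*-≈0ʳ λ₀ r≈0) (*-≈0ʳ (μ x) r₀≈0)) ≈-refl)

      row′-⊥φ : ∀ x → row′ x · φ ≈ 0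
      row′-⊥φ x = ≈-trans (≡⇒≈ (trans (·-linear λ₀ (μ x) (row x) (row x₀) φ) p-multiple)) (p*-≈0 _)
        where
        p-multiple : λ₀ * (row x · φ) + μ x * λ₀ ≡ p * ((row x · φ) * λ₀)
        r = row x · φ
        p-multiple = begin
          λ₀ * r + pred p * r * λ₀     ≡⟨ factor λ₀ r (pred p) ⟩
          suc (pred p) * (r * λ₀)      ≡⟨ cong (_* (r * λ₀)) (suc-pred p) ⟩
          p * (r * λ₀)                 ∎
          where
          open ≡-Reasoning
          factor : ∀ a b k → a * b + k * b * a ≡ suc k * (b * a)
          factor = solve-∀

      row′-pivot : ∀ {x} → x ∈ₛ pivots - x₀ → row′ x x ≉ 0
      row′-pivot {x} x∈F′ row′≈0 = *-≉0 λ≉0 (row-pivot (∈F x∈F′))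
        (≈-trans (≈-sym (+-≈0 _ (*-≈0ʳ (μ x) (row-off-pivot x₀∈F (∈F x∈F′) (≢x₀ x∈F′))))) row′≈0)

      row′-off-pivot : ∀ {x y} → x ∈ₛ pivots - x₀ → y ∈ₛ pivots - x₀ → x ≢ y → row′ x y ≈ 0
      row′-off-pivot {x} x∈F′ y∈F′ x≢y = ≈-trans
        (+-cong (*-≈0ʳ λ₀ (row-off-pivot (∈F x∈F′) (∈F y∈F′) x≢y))
                (*-≈0ʳ (μ x) (row-off-pivot x₀∈F (∈F y∈F′) (≢x₀ y∈F′))))
        ≈-refl

  diagonalFamily : ∀ Φ c → DiagonalFamily Φ c
  diagonalFamily []      c = diagonalFamily-[] c
  diagonalFamily (φ ∷ Φ) c with D ← diagonalFamily Φ c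
    with any? (λ x → x ∈? DiagonalFamily.pivots D ×-dec ¬? ((DiagonalFamily.row D x · φ) ≈0?))
  ... | yes (x₀ , x₀∈F , λ≉0) = diagonalFamily-eliminate D φ x₀∈F λ≉0
  ... | no none = diagonalFamily-keep D φ keep
    where
    keep : ∀ {x} → x ∈ₛ DiagonalFamily.pivots D → DiagonalFamily.row D x · φ ≈ 0
    keep {x} x∈F with (DiagonalFamily.row D x · φ) ≈0?
    ... | yes r≈0 = r≈0
    ... | no r≉0  = ⊥-elim (none (x , x∈F , r≉0))

  annihilator-with-large-support : ∀ Φ c →
    ∃[ h ] All (λ φ → h · φ ≈ 0) Φ × ∣ support c ∣ ≤ length Φ + ∣ support (h ⊙ c) ∣
  annihilator-with-large-support Φ c = h , h⊥Φ , ≤-trans support-bound (+-monoʳ-≤ (length Φ) (p⊆q⇒∣p∣≤∣q∣ pivots⊆support-h⊙c))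
    where
    open DiagonalFamily (diagonalFamily Φ c)

    h : Fin N → ℕ
    h y = ∑[ x < N ] 𝟙 (x ∈? pivots) * row x y

    h⊥Φ : All (λ φ → h · φ ≈ 0) Φ
    h⊥Φ = All.tabulate λ {φ} φ∈Φ → ≈-trans (≡⇒≈ (·-∑ (λ x → 𝟙 (x ∈? pivots)) row φ))
            (∑-≈0 (All.universal (λ x → 𝟙-*-≈0 (x ∈? pivots) (λ x∈F → All.lookup (row-⊥ x∈F) φ∈Φ)) (allFin N)))

    h≈row : ∀ {y} → y ∈ₛ pivots → h y ≈ row y y
    h≈row {y} y∈F = ≈-trans (∑-cong-≈ (allFin N) term) (≡⇒≈ (∑<-𝟙 N y (λ x → row x y)))
      where
      term : ∀ x → 𝟙 (x ∈? pivots) * row x y ≈ 𝟙 (y ≟ᶠ x) * row x y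
      term x with y ≟ᶠ x | x ∈? pivots
      ... | yes refl | yes _    = ≈-refl
      ... | yes refl | no y∉F   = ⊥-elim (y∉F y∈F)
      ... | no y≢x   | yes x∈F  = ≈-trans (≡⇒≈ (+-identityʳ _)) (row-off-pivot x∈F y∈F (λ x≡y → y≢x (sym x≡y)))
      ... | no _     | no _     = ≈-refl

    pivots⊆support-h⊙c : pivots ⊆ support (h ⊙ c)
    pivots⊆support-h⊙c y∈F = ∈-support⁺ (*-≉0 (λ h≈0 → row-pivot y∈F (≈-trans (≈-sym (h≈row y∈F)) h≈0))
                                                (∈-support⁻ (pivots⊆support y∈F)))

module SliceRank (p : ℕ) (prime : Prime p) (N : ℕ) {Key : Set} (keys : List Key) where

  open import Data.Empty using (⊥-elim)
  open import Data.Fin using (Fin; zero; suc)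
  open import Data.Fin.Properties using () renaming (_≟_ to _≟ᶠ_)
  open import Data.Fin.Subset using (∣_∣)
  open import Data.List using (List; map; _++_; length; allFin)
  open import Data.List.Properties using (length-map; length-++)
  open import Data.List.Relation.Unary.All as All using (All)
  open import Data.List.Relation.Unary.All.Properties using (map⁻; ++⁻)
  open import Data.Nat using (ℕ; zero; suc; _+_; _*_; _≤_)
  open import Data.Nat.Properties
  open import Data.Product using (_,_)
  open import Data.Vec.Functional using () renaming (_∷_ to _◂_)
  open import Relation.Binary.PropositionalEquality
  open import Algebra.Properties.CommutativeSemigroup *-commutativeSemigroup using () renaming (x∙yz≈y∙xz to *-left-comm)

  open BigOperators
  open Congruence p prime
  open Orthogonality p prime N

  δ : ∀ {k} → (Fin (suc k) → Fin N) → ℕ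
  δ {k} x = ∏[ i < k ] 𝟙 (x (suc i) ≟ᶠ x zero)

  record SliceDecomposition (k : ℕ) (c : Fin N → ℕ) : Set where
    field
      f          : Fin (suc k) → Key → Fin N → ℕ
      g          : Fin (suc k) → Key → (Fin (suc k) → Fin N) → ℕ
      g-indep    : ∀ i κ {x y} → (∀ l → l ≢ i → x l ≡ y l) → g i κ x ≈ g i κ y
      decomposes : ∀ x → δ x * c (x zero) ≈ (∑[ i < suc k ] ∑[ κ ∈ keys ] f i κ (x i) * g i κ x)

  δ-contract : ∀ {k} (xs : Fin (suc k) → Fin N) (a : Fin N → ℕ) →
               (∑[ j < N ] δ (j ◂ xs) * a j) ≡ δ xs * a (xs zero)
  δ-contract {k} xs a = begin
    (∑[ j < N ] δ (j ◂ xs) * a j)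
      ≡⟨ ∑-cong (allFin N) (λ j → cong (_* a j) (∏<-suc k (λ i → 𝟙 (xs i ≟ᶠ j)))) ⟩
    (∑[ j < N ] 𝟙 (xs zero ≟ᶠ j) * (∏[ i < k ] 𝟙 (xs (suc i) ≟ᶠ j)) * a j)
      ≡⟨ ∑-cong (allFin N) (λ j → *-assoc (𝟙 (xs zero ≟ᶠ j)) _ _) ⟩
    (∑[ j < N ] 𝟙 (xs zero ≟ᶠ j) * ((∏[ i < k ] 𝟙 (xs (suc i) ≟ᶠ j)) * a j))
      ≡⟨ ∑<-𝟙 N (xs zero) (λ j → (∏[ i < k ] 𝟙 (xs (suc i) ≟ᶠ j)) * a j) ⟩
    δ xs * a (xs zero)
      ∎
    where open ≡-Reasoning

  module Contraction {k c} (D : SliceDecomposition (suc k) c) (h : Fin N → ℕ)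
                     (h⊥f₀ : All (λ κ → h · SliceDecomposition.f D zero κ ≈ 0) keys) where
    open SliceDecomposition D

    g′ : Fin (suc k) → Key → (Fin (suc k) → Fin N) → ℕ
    g′ i κ xs = ∑[ j < N ] h j * g (suc i) κ (j ◂ xs)

    g′-indep : ∀ i κ {x y} → (∀ l → l ≢ i → x l ≡ y l) → g′ i κ x ≈ g′ i κ y
    g′-indep i κ {x} {y} x≡y = ∑-cong-≈ (allFin N) (λ j → *-congˡ (h j) (g-indep (suc i) κ (agree j)))
      where
      agree : ∀ j l → l ≢ suc i → (j ◂ x) l ≡ (j ◂ y) l
      agree j zero    _    = refl
      agree j (suc l) l≢i = x≡y l (λ l≡i → l≢i (cong suc l≡i))

    first-variable-vanishes : ∀ xs → (∑[ j < N ] h j * (∑[ κ ∈ keys ] f zero κ j * g zero κ (j ◂ xs))) ≈ 0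
    first-variable-vanishes xs = begin
      (∑[ j < N ] h j * (∑[ κ ∈ keys ] f zero κ j * g zero κ (j ◂ xs)))
        ≈⟨ ∑-cong-≈ (allFin N) (λ j → *-congˡ (h j) (∑-cong-≈ keys (λ κ → *-congˡ (f zero κ j) (g-indep zero κ (agree j))))) ⟩
      (∑[ j < N ] h j * (∑[ κ ∈ keys ] f zero κ j * G κ))
        ≡⟨ ∑-cong (allFin N) (λ j → cong (h j *_) (∑-cong keys (λ κ → *-comm (f zero κ j) (G κ)))) ⟩
      (∑[ j < N ] h j * (∑[ κ ∈ keys ] G κ * f zero κ j))
        ≡⟨ ∑-*-interchange (allFin N) keys h G (f zero) ⟩
      (∑[ κ ∈ keys ] G κ * (h · f zero κ))
        ≈⟨ ∑-≈0 (All.map (λ {κ} → *-≈0ʳ (G κ)) h⊥f₀) ⟩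
      0 ∎
      where
      open ≈-Reasoning
      G : Key → ℕ
      G κ = g zero κ (xs zero ◂ xs)
      agree : ∀ j l → l ≢ zero → (j ◂ xs) l ≡ (xs zero ◂ xs) l
      agree j zero    l≢0 = ⊥-elim (l≢0 refl)
      agree j (suc l) _   = refl

    other-variables : ∀ xs →
      (∑[ j < N ] h j * (∑[ i < suc k ] ∑[ κ ∈ keys ] f (suc i) κ (xs i) * g (suc i) κ (j ◂ xs)))
      ≡ (∑[ i < suc k ] ∑[ κ ∈ keys ] f (suc i) κ (xs i) * g′ i κ xs)
    other-variables xs = begin
      (∑[ j < N ] h j * (∑[ i < suc k ] ∑[ κ ∈ keys ] f (suc i) κ (xs i) * g (suc i) κ (j ◂ xs)))
        ≡⟨ ∑-*-comm (allFin N) (allFin (suc k)) h (λ i j → ∑[ κ ∈ keys ] f (suc i) κ (xs i) * g (suc i) κ (j ◂ xs)) ⟩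
      (∑[ i < suc k ] ∑[ j < N ] h j * (∑[ κ ∈ keys ] f (suc i) κ (xs i) * g (suc i) κ (j ◂ xs)))
        ≡⟨ ∑-cong (allFin (suc k)) (λ i → ∑-*-interchange (allFin N) keys h (λ κ → f (suc i) κ (xs i)) (λ κ j → g (suc i) κ (j ◂ xs))) ⟩
      (∑[ i < suc k ] ∑[ κ ∈ keys ] f (suc i) κ (xs i) * g′ i κ xs)
        ∎
      where open ≡-Reasoning

    contraction : SliceDecomposition k (h ⊙ c)
    contraction = record
      { f          = λ i → f (suc i)
      ; g          = g′
      ; g-indep    = g′-indep
      ; decomposes = decomposes′
      }
      where
      decomposes′ : ∀ xs → δ xs * (h ⊙ c) (xs zero) ≈ (∑[ i < suc k ] ∑[ κ ∈ keys ] f (suc i) κ (xs i) * g′ i κ xs)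
      decomposes′ xs = begin
        δ xs * (h ⊙ c) (xs zero)
          ≡⟨ δ-contract xs (h ⊙ c) ⟨
        (∑[ j < N ] δ (j ◂ xs) * (h j * c j))
          ≡⟨ ∑-cong (allFin N) (λ j → *-left-comm (δ (j ◂ xs)) (h j) (c j)) ⟩
        (∑[ j < N ] h j * (δ (j ◂ xs) * c j))
          ≈⟨ ∑-cong-≈ (allFin N) (λ j → *-congˡ (h j) (decomposes (j ◂ xs))) ⟩
        (∑[ j < N ] h j * (∑[ i < suc (suc k) ] T i j))
          ≡⟨ ∑-cong (allFin N) (λ j → trans (cong (h j *_) (∑<-suc (suc k) (λ i → T i j))) (*-distribˡ-+ (h j) _ _)) ⟩
        (∑[ j < N ] h j * T zero j + h j * (∑[ i < suc k ] T (suc i) j))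
          ≡⟨ ∑-distrib-+ (allFin N) (λ j → h j * T zero j) (λ j → h j * (∑[ i < suc k ] T (suc i) j)) ⟩
        (∑[ j < N ] h j * T zero j) + (∑[ j < N ] h j * (∑[ i < suc k ] T (suc i) j))
          ≈⟨ +-congʳ _ (first-variable-vanishes xs) ⟩
        (∑[ j < N ] h j * (∑[ i < suc k ] T (suc i) j))
          ≡⟨ other-variables xs ⟩
        (∑[ i < suc k ] ∑[ κ ∈ keys ] f (suc i) κ (xs i) * g′ i κ xs)
          ∎
        where
        open ≈-Reasoning
        T : Fin (suc (suc k)) → Fin N → ℕ
        T i j = ∑[ κ ∈ keys ] f i κ ((j ◂ xs) i) * g i κ (j ◂ xs)

  open Contraction using (contraction)

  first-slices : ∀ {k c} → SliceDecomposition (suc k) c → List (Fin N → ℕ)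
  first-slices D = map (SliceDecomposition.f D zero) keys

  diagonal-slices : ∀ {c} → SliceDecomposition 1 c → Key → Fin N → ℕ
  diagonal-slices D κ j = SliceDecomposition.g D (suc zero) κ (λ _ → j)

  -- In two variables the slices of the second variable only depend on the first, so after
  -- contracting the first variable they are the constants h · diagonal-slices D κ.
  two-variable-annihilation : ∀ {c} (D : SliceDecomposition 1 c) h →
    All (λ κ → h · SliceDecomposition.f D zero κ ≈ 0) keys → All (λ κ → h · diagonal-slices D κ ≈ 0) keys →
    ∀ y → (h ⊙ c) y ≈ 0
  two-variable-annihilation {c} D h h⊥f₀ h⊥ψ y = begin
    h y * c y
      ≡⟨ *-identityˡ _ ⟨
    1 * (h y * c y)
      ≈⟨ decomposes′ (λ _ → y) ⟩
    (∑[ κ ∈ keys ] f (suc zero) κ y * g′ zero κ (λ _ → y)) + 0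
      ≈⟨ +-congʳ 0 (∑-cong-≈ keys (λ κ → *-congˡ (f (suc zero) κ y) (g′≈h·ψ κ))) ⟩
    (∑[ κ ∈ keys ] f (suc zero) κ y * (h · diagonal-slices D κ)) + 0
      ≈⟨ +-congʳ 0 (∑-≈0 (All.map (λ {κ} → *-≈0ʳ (f (suc zero) κ y)) h⊥ψ)) ⟩
    0 ∎
    where
    open ≈-Reasoning
    open SliceDecomposition D
    open SliceDecomposition (contraction D h h⊥f₀) using () renaming (g to g′; decomposes to decomposes′)
    agree : ∀ j (l : Fin 2) → l ≢ suc zero → (j ◂ (λ _ → y)) l ≡ j
    agree j zero       _   = refl
    agree j (suc zero) l≢1 = ⊥-elim (l≢1 refl)
    g′≈h·ψ : ∀ κ → g′ zero κ (λ _ → y) ≈ h · diagonal-slices D κ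
    g′≈h·ψ κ = ∑-cong-≈ (allFin N) (λ j → *-congˡ (h j) (g-indep (suc zero) κ (agree j)))

  slice-rank-bound : ∀ k {c} → SliceDecomposition (suc k) c → ∣ support c ∣ ≤ (2 + k) * length keys
  slice-rank-bound zero {c} D
    with h , h⊥ , bound ← annihilator-with-large-support (first-slices D ++ map (diagonal-slices D) keys) c
    with h⊥f₀ , h⊥ψ ← ++⁻ (first-slices D) h⊥ = begin
    ∣ support c ∣                                                                 ≤⟨ bound ⟩
    length (first-slices D ++ map (diagonal-slices D) keys) + ∣ support (h ⊙ c) ∣
      ≡⟨ cong₂ _+_ length-slices (∣support∣≡0 (two-variable-annihilation D h (map⁻ h⊥f₀) (map⁻ h⊥ψ))) ⟩
    2 * length keys + 0                                                           ≡⟨ +-identityʳ _ ⟩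
    2 * length keys                                                               ∎
    where
    open ≤-Reasoning
    length-slices : length (first-slices D ++ map (diagonal-slices D) keys) ≡ 2 * length keys
    length-slices = trans (length-++ (first-slices D))
      (cong₂ _+_ (length-map _ keys) (trans (length-map (diagonal-slices D) keys) (sym (+-identityʳ _))))
  slice-rank-bound (suc k) {c} D
    with h , h⊥ , bound ← annihilator-with-large-support (first-slices D) c = begin
    ∣ support c ∣                                          ≤⟨ bound ⟩
    length (first-slices D) + ∣ support (h ⊙ c) ∣           ≤⟨ +-monoʳ-≤ _ (slice-rank-bound k (contraction D h (map⁻ h⊥))) ⟩
    length (first-slices D) + (2 + k) * length keys          ≡⟨ cong (_+ (2 + k) * length keys) (length-map _ keys) ⟩
    (3 + k) * length keys                                  ∎
    where open ≤-Reasoning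

module Monomials where

  open import Data.List using (List; []; _∷_; [_]; map; _++_; length)
  open import Data.List.Properties using (length-map; length-++)
  open import Data.Nat using (ℕ; zero; suc; _+_; _*_; _^_; _≤_; _≟_; s≤s⁻¹)
  open import Data.Nat.Properties
  open import Data.Nat.Tactic.RingSolver using (solve-∀)
  open import Data.Vec using (Vec; []; _∷_; sum)
  open import Data.Vec.Properties using (≡-dec)
  open import Relation.Binary.Definitions using (DecidableEquality)
  open import Relation.Binary.PropositionalEquality hiding ([_])

  open BigOperators

  infix 4 _≟ᵛ_
  _≟ᵛ_ : ∀ {m} → DecidableEquality (Vec ℕ m)
  _≟ᵛ_ = ≡-dec _≟_

  inc-head : ∀ {m} → Vec ℕ (suc m) → Vec ℕ (suc m)
  inc-head (a ∷ v) = suc a ∷ v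

  exponents : (m d : ℕ) → List (Vec ℕ m)
  exponents zero    d       = [ [] ]
  exponents (suc m) zero    = map (0 ∷_) (exponents m zero)
  exponents (suc m) (suc d) = map (0 ∷_) (exponents m (suc d)) ++ map inc-head (exponents (suc m) d)

  ∑-exponents-𝟙 : ∀ m d (v : Vec ℕ m) (F : Vec ℕ m → ℕ) → sum v ≤ d →
                  (∑[ κ ∈ exponents m d ] 𝟙 (v ≟ᵛ κ) * F κ) ≡ F v
  ∑-exponents-𝟙 zero d [] F _ = trans (+-identityʳ _) (+-identityʳ _)
  ∑-exponents-𝟙 (suc m) zero (zero ∷ u) F u≤0 =
    trans (∑-map (0 ∷_) (exponents m zero) _) (∑-exponents-𝟙 m zero u (λ κ → F (0 ∷ κ)) u≤0)
  ∑-exponents-𝟙 (suc m) (suc d) (zero ∷ u) F u≤d = begin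
    (∑[ κ ∈ map (0 ∷_) (exponents m (suc d)) ++ map inc-head (exponents (suc m) d) ] 𝟙 (0 ∷ u ≟ᵛ κ) * F κ)
      ≡⟨ ∑-++ (map (0 ∷_) (exponents m (suc d))) _ _ ⟩
    (∑[ κ ∈ map (0 ∷_) (exponents m (suc d)) ] 𝟙 (0 ∷ u ≟ᵛ κ) * F κ) + (∑[ κ ∈ map inc-head (exponents (suc m) d) ] 𝟙 (0 ∷ u ≟ᵛ κ) * F κ)
      ≡⟨ cong₂ _+_ (∑-map (0 ∷_) (exponents m (suc d)) _) (∑-map inc-head (exponents (suc m) d) _) ⟩
    (∑[ κ ∈ exponents m (suc d) ] 𝟙 (u ≟ᵛ κ) * F (0 ∷ κ)) + (∑[ κ ∈ exponents (suc m) d ] 𝟙 (0 ∷ u ≟ᵛ inc-head κ) * F (inc-head κ))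
      ≡⟨ cong₂ _+_ (∑-exponents-𝟙 m (suc d) u (λ κ → F (0 ∷ κ)) u≤d) (∑-zero (exponents (suc m) d) λ { (_ ∷ _) → refl }) ⟩
    F (0 ∷ u) + 0
      ≡⟨ +-identityʳ _ ⟩
    F (0 ∷ u) ∎
    where open ≡-Reasoning
  ∑-exponents-𝟙 (suc m) (suc d) (suc a ∷ u) F a+u≤d = begin
    (∑[ κ ∈ map (0 ∷_) (exponents m (suc d)) ++ map inc-head (exponents (suc m) d) ] 𝟙 (suc a ∷ u ≟ᵛ κ) * F κ)
      ≡⟨ ∑-++ (map (0 ∷_) (exponents m (suc d))) _ _ ⟩
    (∑[ κ ∈ map (0 ∷_) (exponents m (suc d)) ] 𝟙 (suc a ∷ u ≟ᵛ κ) * F κ) + (∑[ κ ∈ map inc-head (exponents (suc m) d) ] 𝟙 (suc a ∷ u ≟ᵛ κ) * F κ)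
      ≡⟨ cong₂ _+_ (trans (∑-map (0 ∷_) (exponents m (suc d)) _) (∑-zero (exponents m (suc d)) (λ _ → refl))) (∑-map inc-head (exponents (suc m) d) _) ⟩
    (∑[ κ ∈ exponents (suc m) d ] 𝟙 (suc a ∷ u ≟ᵛ inc-head κ) * F (inc-head κ))
      ≡⟨ ∑-cong (exponents (suc m) d) (λ { (_ ∷ _) → refl }) ⟩
    (∑[ κ ∈ exponents (suc m) d ] 𝟙 (a ∷ u ≟ᵛ κ) * F (inc-head κ))
      ≡⟨ ∑-exponents-𝟙 (suc m) d (a ∷ u) (λ κ → F (inc-head κ)) (s≤s⁻¹ a+u≤d) ⟩
    F (suc a ∷ u) ∎
    where open ≡-Reasoning

  length-exponents : ∀ m d X Y → length (exponents m d) * (X ^ d * Y ^ m) ≤ (X + Y) ^ (m + d)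
  length-exponents zero d X Y = begin
    1 * (X ^ d * 1)    ≡⟨ trans (*-identityˡ _) (*-identityʳ _) ⟩
    X ^ d              ≤⟨ ^-monoˡ-≤ d (m≤m+n X Y) ⟩
    (X + Y) ^ d        ∎
    where open ≤-Reasoning
  length-exponents (suc m) zero X Y = begin
    length (map (0 ∷_) (exponents m zero)) * (1 * (Y * Y ^ m))   ≡⟨ cong (_* (1 * (Y * Y ^ m))) (length-map (0 ∷_) (exponents m zero)) ⟩
    length (exponents m zero) * (1 * (Y * Y ^ m))                ≡⟨ rearrange (length (exponents m zero)) Y (Y ^ m) ⟩
    Y * (length (exponents m zero) * (1 * Y ^ m))                ≤⟨ *-mono-≤ (m≤n+m Y X) (length-exponents m zero X Y) ⟩
    (X + Y) * (X + Y) ^ (m + zero)                               ∎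
    where
    open ≤-Reasoning
    rearrange : ∀ L y z → L * (1 * (y * z)) ≡ y * (L * (1 * z))
    rearrange = solve-∀
  length-exponents (suc m) (suc d) X Y = begin
    length (map (0 ∷_) (exponents m (suc d)) ++ map inc-head (exponents (suc m) d)) * (X * X ^ d * (Y * Y ^ m))
      ≡⟨ cong (_* (X * X ^ d * (Y * Y ^ m))) length-split ⟩
    (L₁ + L₂) * (X * X ^ d * (Y * Y ^ m))
      ≡⟨ rearrange L₁ L₂ X Y (X ^ d) (Y ^ m) ⟩
    L₁ * (X * X ^ d * Y ^ m) * Y + L₂ * (X ^ d * (Y * Y ^ m)) * X
      ≤⟨ +-mono-≤ (*-monoˡ-≤ Y (length-exponents m (suc d) X Y)) (*-monoˡ-≤ X (length-exponents (suc m) d X Y)) ⟩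
    (X + Y) ^ (m + suc d) * Y + (X + Y) ^ (suc m + d) * X
      ≡⟨ cong (λ e → (X + Y) ^ e * Y + (X + Y) ^ (suc m + d) * X) (+-suc m d) ⟩
    (X + Y) ^ (suc m + d) * Y + (X + Y) ^ (suc m + d) * X
      ≡⟨ collect ((X + Y) ^ (suc m + d)) X Y ⟩
    (X + Y) * (X + Y) ^ (suc m + d)
      ≡⟨ cong (λ e → (X + Y) * (X + Y) ^ e) (+-suc m d) ⟨
    (X + Y) ^ (suc m + suc d) ∎
    where
    open ≤-Reasoning
    L₁ = length (exponents m (suc d))
    L₂ = length (exponents (suc m) d)
    length-split : length (map (0 ∷_) (exponents m (suc d)) ++ map inc-head (exponents (suc m) d)) ≡ L₁ + L₂
    length-split = trans (length-++ (map (0 ∷_) (exponents m (suc d))))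
                         (cong₂ _+_ (length-map (0 ∷_) (exponents m (suc d))) (length-map inc-head (exponents (suc m) d)))
    rearrange : ∀ L₁ L₂ X Y Xd Ym → (L₁ + L₂) * (X * Xd * (Y * Ym)) ≡ L₁ * (X * Xd * Ym) * Y + L₂ * (Xd * (Y * Ym)) * X
    rearrange = solve-∀
    collect : ∀ P X Y → P * Y + P * X ≡ (X + Y) * P
    collect = solve-∀

module ZeroSumPolynomial (k : ℕ) (prime : Prime (2 + k)) {m N : ℕ} (point : Fin N → Zpn (2 + k) m)
  (only-constant : ∀ (x : Fin (2 + k) → Fin N) → SumsToZero (λ i → point (x i)) → ∀ i j → x i ≡ x j)
  where

  open import Data.Empty using (⊥-elim)
  open import Data.Fin using (Fin; zero; suc; toℕ; fromℕ<)
  open import Data.Fin.Properties using (toℕ<n; toℕ-fromℕ<; ¬∀⟶∃¬; all?) renaming (_≟_ to _≟ᶠ_)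
  open import Data.List using (List; allFin; length)
  open import Data.List.Membership.Propositional.Properties using (∈-allFin)
  open import Data.Nat using (ℕ; zero; suc; _+_; _*_; _^_; _∸_; _≤_; _<_; s≤s; z≤n; z<s; s<s⁻¹)
  open import Data.Nat.DivMod using (_%_; m%n<n; m%n%n≡m%n; m*n%n≡0)
  open import Data.Nat.Properties
  open import Data.Nat.Tactic.RingSolver using (solve-∀)
  open import Data.Product using (∃-syntax; _,_; proj₁; proj₂)
  open import Data.Vec using (Vec; lookup; tabulate; sum)
  open import Data.Vec.Properties using (lookup∘tabulate)
  open import Relation.Binary.PropositionalEquality
  open import Relation.Nullary using (yes; no; ¬_)

  open BigOperators
  open Congruence (2 + k) prime

  p q : ℕ
  p = 2 + k
  q = suc k

  coord : Fin N → Fin m → ℕ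
  coord j l = toℕ (lookup (point j) l)

  coord-sum : (Fin p → Fin N) → Fin m → ℕ
  coord-sum x l = ∑[ i < p ] coord (x i) l

  -- Since q ≡ -1, factor a σ is a + 1 - σ; the product of these over a is nonzero exactly when σ ≡ 0.
  factor : Fin q → ℕ → ℕ
  factor a σ = suc (toℕ a) + q * σ

  F : (Fin p → Fin N) → ℕ
  F x = ∏[ l < m ] ∏[ a < q ] factor a (coord-sum x l)

  F-cong : ∀ {x y} → (∀ i → x i ≡ y i) → F x ≡ F y
  F-cong x≗y = ∏-cong (allFin m) λ l → ∏-cong (allFin q) λ a →
    cong (factor a) (∑-cong (allFin p) (λ i → cong (λ j → coord j l) (x≗y i)))

  F-diagonal-≉0 : ∀ j → F (λ _ → j) ≉ 0
  F-diagonal-≉0 j = ∏-≉0 (allFin m) λ l → ∏-≉0 (allFin q) λ a factor≈0 →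
    0<n<p⇒≉0 z<s (s≤s (toℕ<n a)) (≈-trans (≈-sym (factor-constant l a)) factor≈0)
    where
    factor-constant : ∀ l a → factor a (coord-sum (λ _ → j) l) ≈ suc (toℕ a)
    factor-constant l a = begin
      suc (toℕ a) + q * (∑[ i < p ] coord j l)   ≡⟨ cong (λ σ → suc (toℕ a) + q * σ) (∑<-const p (coord j l)) ⟩
      suc (toℕ a) + q * (p * coord j l)          ≡⟨ cong (suc (toℕ a) +_) (*-left-comm q p (coord j l)) ⟩
      suc (toℕ a) + p * (q * coord j l)          ≈⟨ +-≈0 (suc (toℕ a)) (p*-≈0 (q * coord j l)) ⟩
      suc (toℕ a)                                ∎
      where
      open ≈-Reasoning
      *-left-comm : ∀ a b c → a * (b * c) ≡ b * (a * c)
      *-left-comm = solve-∀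

  factor-root : ∀ σ → σ ≉ 0 → ∃[ a ] factor a σ ≈ 0
  factor-root σ σ≉0 with σ % p in σ%p≡r | m%n<n σ p
  ... | zero  | _     = ⊥-elim (σ≉0 (mod-≡ (trans σ%p≡r (sym (m*n%n≡0 0 p)))))
  ... | suc r | r<q+1 = fromℕ< (s<s⁻¹ r<q+1) , (begin
    suc (toℕ (fromℕ< (s<s⁻¹ r<q+1))) + q * σ   ≡⟨ cong (λ t → suc t + q * σ) (toℕ-fromℕ< (s<s⁻¹ r<q+1)) ⟩
    suc r + q * σ                             ≈⟨ +-congʳ (q * σ) r≈σ ⟩
    p * σ                                     ≈⟨ p*-≈0 σ ⟩
    0                                         ∎)
    where
    open ≈-Reasoning
    r≈σ : suc r ≈ σ
    r≈σ = mod-≡ (trans (cong (_% p) (sym σ%p≡r)) (m%n%n≡m%n σ p))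

  coord-sum-≈0⇒SumsToZero : ∀ x → (∀ l → coord-sum x l ≈ 0) → SumsToZero (λ i → point (x i))
  coord-sum-≈0⇒SumsToZero x σ≈0 l = ≈0⇒∣ (subst (_≈ 0) (sym (sum-tabulate p (λ i → coord (x i) l))) (σ≈0 l))

  F-off-diagonal-≈0 : ∀ x → ¬ (∀ i → x i ≡ x zero) → F x ≈ 0
  F-off-diagonal-≈0 x non-constant
    with l , σ≉0 ← ¬∀⟶∃¬ m _ (λ l → coord-sum x l ≈0?) (λ σ≈0 → non-constant (λ i → only-constant x (coord-sum-≈0⇒SumsToZero x σ≈0) i zero))
    with a , root ← factor-root (coord-sum x l) σ≉0
    = ∏-≈0 (λ l → ∏[ a < q ] factor a (coord-sum x l)) (∈-allFin l) (∏-≈0 (λ a → factor a (coord-sum x l)) (∈-allFin a) root)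

  weight : Fin q → Fin (suc p) → ℕ
  weight a zero    = suc (toℕ a)
  weight a (suc _) = q

  exponent : Fin (suc p) → Fin p → ℕ
  exponent zero     i = 0
  exponent (suc i₀) i = 𝟙 (i₀ ≟ᶠ i)

  term : Fin m → Fin q → Fin (suc p) → (Fin p → Fin N) → ℕ
  term l a c x = weight a c * (∏[ i < p ] coord (x i) l ^ exponent c i)

  factor-expand : ∀ x l a → factor a (coord-sum x l) ≡ (∑[ c < suc p ] term l a c x)
  factor-expand x l a = sym (begin
    (∑[ c < suc p ] term l a c x)
      ≡⟨ ∑<-suc p (λ c → term l a c x) ⟩
    suc (toℕ a) * (∏[ i < p ] 1) + (∑[ i₀ < p ] q * (∏[ i < p ] coord (x i) l ^ 𝟙 (i₀ ≟ᶠ i)))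
      ≡⟨ cong₂ _+_ (trans (cong (suc (toℕ a) *_) (∏-one (allFin p) (λ _ → refl))) (*-identityʳ (suc (toℕ a))))
                   (∑-cong (allFin p) (λ i₀ → cong (q *_) (∏<-𝟙 p i₀ (λ i → coord (x i) l)))) ⟩
    suc (toℕ a) + (∑[ i₀ < p ] q * coord (x i₀) l)
      ≡⟨ cong (suc (toℕ a) +_) (*-distribˡ-∑ (allFin p) q (λ i₀ → coord (x i₀) l)) ⟨
    factor a (coord-sum x l) ∎)
    where open ≡-Reasoning

  Choice : Set
  Choice = Fin m → Fin q → Fin (suc p)

  choices : List Choice
  choices = allFunctions m (allFunctions q (allFin (suc p)))

  Term : Choice → (Fin p → Fin N) → ℕ
  Term C x = ∏[ l < m ] ∏[ a < q ] term l a (C l a) x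

  F-expand : ∀ x → F x ≡ (∑[ C ∈ choices ] Term C x)
  F-expand x = begin
    F x                                                                   ≡⟨ ∏-cong (allFin m) (λ l → ∏-cong (allFin q) (factor-expand x l)) ⟩
    (∏[ l < m ] ∏[ a < q ] ∑[ c < suc p ] term l a c x)                   ≡⟨ ∏-cong (allFin m) (λ l → ∏-∑-distrib q (allFin (suc p)) (λ a c → term l a c x)) ⟩
    (∏[ l < m ] ∑[ Cₗ ∈ allFunctions q (allFin (suc p)) ] ∏[ a < q ] term l a (Cₗ a) x)
                                                                          ≡⟨ ∏-∑-distrib m (allFunctions q (allFin (suc p))) (λ l Cₗ → ∏[ a < q ] term l a (Cₗ a) x) ⟩
    (∑[ C ∈ choices ] Term C x)                                           ∎
    where open ≡-Reasoning

  coefficient : Choice → ℕ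
  coefficient C = ∏[ l < m ] ∏[ a < q ] weight a (C l a)

  key : Choice → Fin p → Vec ℕ m
  key C i = tabulate (λ l → ∑[ a < q ] exponent (C l a) i)

  monomial : Vec ℕ m → Fin N → ℕ
  monomial κ j = ∏[ l < m ] coord j l ^ lookup κ l

  Term-split : ∀ C x → Term C x ≡ coefficient C * (∏[ i < p ] monomial (key C i) (x i))
  Term-split C x = begin
    Term C x
      ≡⟨ ∏-cong (allFin m) (λ l → ∏-distrib-* (allFin q) (λ a → weight a (C l a)) _) ⟩
    (∏[ l < m ] (∏[ a < q ] weight a (C l a)) * (∏[ a < q ] ∏[ i < p ] coord (x i) l ^ exponent (C l a) i))
      ≡⟨ ∏-distrib-* (allFin m) _ _ ⟩
    coefficient C * (∏[ l < m ] ∏[ a < q ] ∏[ i < p ] coord (x i) l ^ exponent (C l a) i)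
      ≡⟨ cong (coefficient C *_) (∏-cong (allFin m) (λ l → ∏-comm (allFin q) (allFin p) (λ a i → coord (x i) l ^ exponent (C l a) i))) ⟩
    coefficient C * (∏[ l < m ] ∏[ i < p ] ∏[ a < q ] coord (x i) l ^ exponent (C l a) i)
      ≡⟨ cong (coefficient C *_) (∏-cong (allFin m) (λ l → ∏-cong (allFin p) (λ i → ∏-^ (allFin q) (coord (x i) l) (λ a → exponent (C l a) i)))) ⟩
    coefficient C * (∏[ l < m ] ∏[ i < p ] coord (x i) l ^ (∑[ a < q ] exponent (C l a) i))
      ≡⟨ cong (coefficient C *_) (∏-comm (allFin m) (allFin p) (λ l i → coord (x i) l ^ (∑[ a < q ] exponent (C l a) i))) ⟩
    coefficient C * (∏[ i < p ] ∏[ l < m ] coord (x i) l ^ (∑[ a < q ] exponent (C l a) i))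
      ≡⟨ cong (coefficient C *_) (∏-cong (allFin p) (λ i → ∏-cong (allFin m) (λ l →
           cong (coord (x i) l ^_) (sym (lookup∘tabulate (λ l → ∑[ a < q ] exponent (C l a) i) l))))) ⟩
    coefficient C * (∏[ i < p ] monomial (key C i) (x i))
      ∎
    where open ≡-Reasoning

  exponent-sum≤1 : ∀ c → (∑[ i < p ] exponent c i) ≤ 1
  exponent-sum≤1 zero     = ≤-trans (≤-reflexive (∑-zero (allFin p) (λ _ → refl))) z≤n
  exponent-sum≤1 (suc i₀) = ≤-reflexive (trans (∑-cong (allFin p) (λ i → sym (*-identityʳ (𝟙 (i₀ ≟ᶠ i))))) (∑<-𝟙 p i₀ (λ _ → 1)))

  total-degree : ∀ C → (∑[ i < p ] sum (key C i)) ≤ m * q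
  total-degree C = begin
    (∑[ i < p ] sum (key C i))                           ≡⟨ ∑-cong (allFin p) (λ i → sum-tabulate m (λ l → ∑[ a < q ] exponent (C l a) i)) ⟩
    (∑[ i < p ] ∑[ l < m ] ∑[ a < q ] exponent (C l a) i) ≡⟨ ∑-comm (allFin p) (allFin m) (λ i l → ∑[ a < q ] exponent (C l a) i) ⟩
    (∑[ l < m ] ∑[ i < p ] ∑[ a < q ] exponent (C l a) i) ≡⟨ ∑-cong (allFin m) (λ l → ∑-comm (allFin p) (allFin q) (λ i a → exponent (C l a) i)) ⟩
    (∑[ l < m ] ∑[ a < q ] ∑[ i < p ] exponent (C l a) i) ≤⟨ ∑-mono-≤ (allFin m) (λ l → ∑-mono-≤ (allFin q) (λ a → exponent-sum≤1 (C l a))) ⟩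
    (∑[ l < m ] ∑[ a < q ] 1)                             ≡⟨ ∑-cong (allFin m) (λ l → trans (∑<-const q 1) (*-identityʳ q)) ⟩
    (∑[ l < m ] q)                                        ≡⟨ ∑<-const m q ⟩
    m * q                                                 ∎
    where open ≤-Reasoning

  module _ (D : ℕ) (m*q≤p*D : m * q ≤ p * D) where

    open Monomials
    open Orthogonality p prime N using (∣support∣≡N)
    open SliceRank p prime N (exponents m D)

    -- Each choice has a variable of degree at most m q / p; the monomial in that variable is its slice.
    selected : Choice → Fin p
    selected C = proj₁ (∃-≤-average (suc k) (λ i → sum (key C i)) (m * q) (total-degree C))

    selected-degree : ∀ C → sum (key C (selected C)) ≤ D
    selected-degree C = *-cancelˡ-≤ p (≤-trans (proj₂ (∃-≤-average (suc k) (λ i → sum (key C i)) (m * q) (total-degree C))) m*q≤p*D)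

    rest : Fin p → Choice → (Fin p → Fin N) → ℕ
    rest i C x = coefficient C * (∏[ j < p ] monomial (key C j) (x j) ^ (1 ∸ 𝟙 (i ≟ᶠ j)))

    Term-at : ∀ i C x → Term C x ≡ monomial (key C i) (x i) * rest i C x
    Term-at i C x = begin
      Term C x                                                                       ≡⟨ Term-split C x ⟩
      coefficient C * (∏[ j < p ] monomial (key C j) (x j))                           ≡⟨ cong (coefficient C *_) (∏<-except p i (λ j → monomial (key C j) (x j))) ⟨
      coefficient C * (monomial (key C i) (x i) * (∏[ j < p ] monomial (key C j) (x j) ^ (1 ∸ 𝟙 (i ≟ᶠ j))))
                                                                                     ≡⟨ *-left-comm (coefficient C) (monomial (key C i) (x i)) _ ⟩
      monomial (key C i) (x i) * rest i C x                                          ∎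
      where
      open ≡-Reasoning
      *-left-comm : ∀ a b c → a * (b * c) ≡ b * (a * c)
      *-left-comm = solve-∀

    G : Fin p → Vec ℕ m → (Fin p → Fin N) → ℕ
    G i κ x = ∑[ C ∈ choices ] 𝟙 (selected C ≟ᶠ i) * (𝟙 (key C i ≟ᵛ κ) * rest i C x)

    G-indep : ∀ i κ {x y} → (∀ j → j ≢ i → x j ≡ y j) → G i κ x ≡ G i κ y
    G-indep i κ {x} {y} x≡y = ∑-cong choices λ C →
      cong (λ r → 𝟙 (selected C ≟ᶠ i) * (𝟙 (key C i ≟ᵛ κ) * (coefficient C * r))) (∏-cong (allFin p) (agree C))
      where
      agree : ∀ C j → monomial (key C j) (x j) ^ (1 ∸ 𝟙 (i ≟ᶠ j)) ≡ monomial (key C j) (y j) ^ (1 ∸ 𝟙 (i ≟ᶠ j))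
      agree C j with i ≟ᶠ j
      ... | yes _   = refl
      ... | no  i≢j = cong (λ z → monomial (key C j) z ^ 1) (x≡y j (λ j≡i → i≢j (sym j≡i)))

    F-decomposes : ∀ x → F x ≡ (∑[ i < p ] ∑[ κ ∈ exponents m D ] monomial κ (x i) * G i κ x)
    F-decomposes x = begin
      F x
        ≡⟨ F-expand x ⟩
      (∑[ C ∈ choices ] Term C x)
        ≡⟨ ∑-cong choices (λ C → Term-at (selected C) C x) ⟩
      (∑[ C ∈ choices ] monomial (key C (selected C)) (x (selected C)) * rest (selected C) C x)
        ≡⟨ ∑-cong choices (λ C → ∑-exponents-𝟙 m D (key C (selected C)) (λ κ → monomial κ (x (selected C)) * rest (selected C) C x) (selected-degree C)) ⟨
      (∑[ C ∈ choices ] ∑[ κ ∈ exponents m D ] 𝟙 (key C (selected C) ≟ᵛ κ) * (monomial κ (x (selected C)) * rest (selected C) C x))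
        ≡⟨ ∑-cong choices (λ C → ∑<-𝟙 p (selected C) (λ i → ∑[ κ ∈ exponents m D ] 𝟙 (key C i ≟ᵛ κ) * (monomial κ (x i) * rest i C x))) ⟨
      (∑[ C ∈ choices ] ∑[ i < p ] 𝟙 (selected C ≟ᶠ i) * (∑[ κ ∈ exponents m D ] 𝟙 (key C i ≟ᵛ κ) * (monomial κ (x i) * rest i C x)))
        ≡⟨ ∑-cong choices (λ C → ∑-cong (allFin p) (λ i → *-distribˡ-∑ (exponents m D) (𝟙 (selected C ≟ᶠ i)) _)) ⟩
      (∑[ C ∈ choices ] ∑[ i < p ] ∑[ κ ∈ exponents m D ] 𝟙 (selected C ≟ᶠ i) * (𝟙 (key C i ≟ᵛ κ) * (monomial κ (x i) * rest i C x)))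
        ≡⟨ ∑-comm choices (allFin p) _ ⟩
      (∑[ i < p ] ∑[ C ∈ choices ] ∑[ κ ∈ exponents m D ] 𝟙 (selected C ≟ᶠ i) * (𝟙 (key C i ≟ᵛ κ) * (monomial κ (x i) * rest i C x)))
        ≡⟨ ∑-cong (allFin p) (λ i → ∑-comm choices (exponents m D) _) ⟩
      (∑[ i < p ] ∑[ κ ∈ exponents m D ] ∑[ C ∈ choices ] 𝟙 (selected C ≟ᶠ i) * (𝟙 (key C i ≟ᵛ κ) * (monomial κ (x i) * rest i C x)))
        ≡⟨ ∑-cong (allFin p) (λ i → ∑-cong (exponents m D) (λ κ → ∑-cong choices (λ C → pull-out (𝟙 (selected C ≟ᶠ i)) (𝟙 (key C i ≟ᵛ κ)) (monomial κ (x i)) (rest i C x)))) ⟩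
      (∑[ i < p ] ∑[ κ ∈ exponents m D ] ∑[ C ∈ choices ] monomial κ (x i) * (𝟙 (selected C ≟ᶠ i) * (𝟙 (key C i ≟ᵛ κ) * rest i C x)))
        ≡⟨ ∑-cong (allFin p) (λ i → ∑-cong (exponents m D) (λ κ → *-distribˡ-∑ choices (monomial κ (x i)) _)) ⟨
      (∑[ i < p ] ∑[ κ ∈ exponents m D ] monomial κ (x i) * G i κ x)
        ∎
      where
      open ≡-Reasoning
      pull-out : ∀ a b c d → a * (b * (c * d)) ≡ c * (a * (b * d))
      pull-out = solve-∀

    c : Fin N → ℕ
    c j = F (λ _ → j)

    δ-diagonal : ∀ x → δ x * c (x zero) ≈ F x
    δ-diagonal x with all? (λ i → x (suc i) ≟ᶠ x zero)
    ... | yes constant = ≡⇒≈ (begin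
      δ x * c (x zero)   ≡⟨ cong (_* c (x zero)) (∏-one (allFin q) (λ i → 𝟙-yes (x (suc i) ≟ᶠ x zero) (constant i))) ⟩
      1 * c (x zero)     ≡⟨ *-identityˡ _ ⟩
      F (λ _ → x zero)   ≡⟨ F-cong (λ { zero → refl ; (suc i) → sym (constant i) }) ⟩
      F x                ∎)
      where open ≡-Reasoning
    ... | no non-constant with i , x≢ ← ¬∀⟶∃¬ q _ (λ i → x (suc i) ≟ᶠ x zero) non-constant =
      ≈-trans (*-≈0ˡ (c (x zero)) (∏-≈0 (λ i → 𝟙 (x (suc i) ≟ᶠ x zero)) (∈-allFin i) (≡⇒≈ (𝟙-no (x (suc i) ≟ᶠ x zero) x≢))))
              (≈-sym (F-off-diagonal-≈0 x (λ constant → x≢ (constant (suc i)))))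

    decomposition : SliceDecomposition q c
    decomposition = record
      { f          = λ _ κ → monomial κ
      ; g          = G
      ; g-indep    = λ i κ x≡y → ≡⇒≈ (G-indep i κ x≡y)
      ; decomposes = λ x → ≈-trans (δ-diagonal x) (≡⇒≈ (F-decomposes x))
      }

    size-bound : N ≤ p * length (exponents m D)
    size-bound = ≤-trans (≤-reflexive (sym (∣support∣≡N F-diagonal-≉0))) (slice-rank-bound k decomposition)

module ZeroSums where

  open import Data.Empty using (⊥-elim)
  open import Data.Fin using (Fin; zero; suc; toℕ; _↑ˡ_; _↑ʳ_)
  open import Data.Fin.Properties using (any?; all?) renaming (_≟_ to _≟ᶠ_)
  open import Data.List as List using (List; []; _∷_; [_]; map; length; cartesianProductWith)
  open import Data.List.Membership.Propositional using (_∈_; find; lose)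
  open import Data.List.Membership.Propositional.Properties
    using (∈-map⁺; ∈-map⁻; ∈-concatMap⁺; ∈-concatMap⁻; ∈-cartesianProductWith⁻; ∈-lookup)
  open import Data.List.Properties using (length-++; length-map)
  open import Data.List.Relation.Unary.Any as Any using (here)
  open import Data.List.Relation.Unary.Unique.Propositional using (Unique)
  import Data.List.Relation.Unary.All as All
  import Data.List.Relation.Unary.AllPairs as AllPairs
  open import Data.List.Relation.Unary.Unique.Propositional.Properties using (cartesianProductWith⁺)
  open import Data.Nat as ℕ using (ℕ; _+_; _*_; _^_)
  open import Data.Nat.Divisibility using (_∣_; _∣?_)
  open import Data.Product using (Σ; ∃; ∃₂; ∃-syntax; _×_; _,_; proj₁; proj₂)
  open import Data.Sum using (_⊎_; inj₁; inj₂)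
  open import Data.Vec using (Vec; []; _++_; lookup; tabulate; sum)
  open import Data.Vec.Properties using (≡-dec; lookup-++ˡ; lookup-++ʳ; tabulate-cong; ++-injective)
  open import Data.Vec.Functional using () renaming (_∷_ to _◂_)
  open import Relation.Binary.PropositionalEquality hiding ([_])
  open import Relation.Nullary using (Dec; yes; no; ¬?)
  open import Relation.Nullary.Decidable using (_×-dec_)

  open BigOperators using (allFunctions)

  NontrivialZeroSum : ∀ {p n} → List (Zpn p n) → Set
  NontrivialZeroSum {p} {n} A =
    Σ (Fin p → Zpn p n) λ v → ((i : Fin p) → v i ∈ A) × (∃ λ i → ∃ λ j → v i ≢ v j) × SumsToZero v

  OnlyConstantZeroSums : ∀ {p n} → List (Zpn p n) → Set
  OnlyConstantZeroSums {p} {n} A = ∀ (v : Fin p → Zpn p n) → (∀ i → v i ∈ A) → SumsToZero v → ∀ i j → v i ≡ v j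

  SumsToZero-reindex : ∀ {p n n′} {v : Fin p → Zpn p n} {w : Fin p → Zpn p n′} (f : Fin n′ → Fin n) →
                       (∀ i l → lookup (v i) (f l) ≡ lookup (w i) l) → SumsToZero v → SumsToZero w
  SumsToZero-reindex {p} f v≡w v↦0 l =
    subst (p ∣_) (cong sum (tabulate-cong (λ i → cong toℕ (v≡w i l)))) (v↦0 (f l))

  SumsToZero-cong : ∀ {p n} {v w : Fin p → Zpn p n} → (∀ i → v i ≡ w i) → SumsToZero v → SumsToZero w
  SumsToZero-cong {v = v} {w} v≗w = SumsToZero-reindex {v = v} {w} (λ l → l) (λ i l → cong (λ u → lookup u l) (v≗w i))

  SumsToZero? : ∀ {p n} (v : Fin p → Zpn p n) → Dec (SumsToZero v)
  SumsToZero? {p} v = all? (λ l → p ∣? sum (tabulate (λ i → toℕ (lookup (v i) l))))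

  module _ {A : Set} where

    allFunctions-sound : ∀ n (M : List A) {C} → C ∈ allFunctions n M → ∀ i → C i ∈ M
    allFunctions-sound (ℕ.suc n) M C∈ i with find (∈-concatMap⁻ (λ a → map (a ◂_) (allFunctions n M)) {xs = M} C∈)
    ... | a , a∈M , C∈aM with ∈-map⁻ (a ◂_) C∈aM | i
    ... | _ , _   , refl | zero  = a∈M
    ... | _ , C∈  , refl | suc i = allFunctions-sound n M C∈ i

    allFunctions-complete : ∀ n (M : List A) (x : Fin n → A) → (∀ i → x i ∈ M) →
                         ∃[ C ] C ∈ allFunctions n M × (∀ i → C i ≡ x i)
    allFunctions-complete ℕ.zero    M x x∈M = (λ ()) , here refl , λ ()
    allFunctions-complete (ℕ.suc n) M x x∈M with allFunctions-complete n M (λ i → x (suc i)) (λ i → x∈M (suc i))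
    ... | C , C∈ , C≗x = x zero ◂ C , ∈-concatMap⁺ (λ a → map (a ◂_) (allFunctions n M)) (Any.map (λ { refl → ∈-map⁺ (x zero ◂_) C∈ }) (x∈M zero)) , agree
      where
      agree : ∀ i → (x zero ◂ C) i ≡ x i
      agree zero    = refl
      agree (suc i) = C≗x i

  nontrivial-zero-sum? : ∀ {p n} (A : List (Zpn p n)) → NontrivialZeroSum A ⊎ OnlyConstantZeroSums A
  nontrivial-zero-sum? {p} {n} A with Any.any? (λ v → nonconstant? v ×-dec SumsToZero? v) (allFunctions p A)
    where
    nonconstant? : (v : Fin p → Zpn p n) → Dec (∃ λ i → ∃ λ j → v i ≢ v j)
    nonconstant? v = any? (λ i → any? (λ j → ¬? (≡-dec _≟ᶠ_ (v i) (v j))))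
  ... | yes found with v , v∈ , nonconstant , v↦0 ← find found = inj₁ (v , allFunctions-sound p A v∈ , nonconstant , v↦0)
  ... | no none = inj₂ only-constant
    where
    only-constant : OnlyConstantZeroSums A
    only-constant v v∈A v↦0 i j with ≡-dec _≟ᶠ_ (v i) (v j)
    ... | yes vi≡vj = vi≡vj
    ... | no vi≢vj with C , C∈ , C≗v ← allFunctions-complete p A v v∈A =
      ⊥-elim (none (lose C∈ ((i , j , λ Ci≡Cj → vi≢vj (trans (sym (C≗v i)) (trans Ci≡Cj (C≗v j))))
                            , SumsToZero-cong (λ i → sym (C≗v i)) v↦0)))

  length-cartesianProductWith : ∀ {X Y Z : Set} (f : X → Y → Z) xs ys →
                                length (cartesianProductWith f xs ys) ≡ length xs * length ys
  length-cartesianProductWith f []       ys = refl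
  length-cartesianProductWith f (x ∷ xs) ys =
    trans (length-++ (map (f x) ys)) (cong₂ _+_ (length-map (f x) ys) (length-cartesianProductWith f xs ys))

  SumsToZero-++ : ∀ {p n n′} {v : Fin p → Zpn p (n + n′)} (a : Fin p → Zpn p n) (b : Fin p → Zpn p n′) →
                  (∀ i → v i ≡ a i ++ b i) → SumsToZero v → SumsToZero a × SumsToZero b
  SumsToZero-++ {n = n} {n′} {v} a b v≡ab v↦0 =
    SumsToZero-reindex {v = v} {a} (_↑ˡ n′) (λ i l → trans (cong (λ u → lookup u (l ↑ˡ n′)) (v≡ab i)) (lookup-++ˡ (a i) (b i) l)) v↦0 ,
    SumsToZero-reindex {v = v} {b} (n ↑ʳ_) (λ i l → trans (cong (λ u → lookup u (n ↑ʳ l)) (v≡ab i)) (lookup-++ʳ (a i) (b i) l)) v↦0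

  module _ {p n : ℕ} where

    power : ∀ K → List (Zpn p n) → List (Zpn p (K * n))
    power ℕ.zero    A = [ [] ]
    power (ℕ.suc K) A = cartesianProductWith _++_ A (power K A)

    length-power : ∀ K A → length (power K A) ≡ length A ^ K
    length-power ℕ.zero    A = refl
    length-power (ℕ.suc K) A = trans (length-cartesianProductWith _++_ A (power K A)) (cong (length A *_) (length-power K A))

    unique-power : ∀ K {A} → Unique A → Unique (power K A)
    unique-power ℕ.zero    _ = All.[] AllPairs.∷ AllPairs.[]
    unique-power (ℕ.suc K) A! = cartesianProductWith⁺ _++_ (λ {w} {x} → ++-injective w x) A! (unique-power K A!)

    only-constant-power : ∀ K {A} → OnlyConstantZeroSums A → OnlyConstantZeroSums (power K A)
    only-constant-power ℕ.zero _ v _ _ i j with v i | v j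
    ... | [] | [] = refl
    only-constant-power (ℕ.suc K) {A} A-trivial v v∈ v↦0 i j = begin
      v i           ≡⟨ v≡ab i ⟩
      a i ++ b i    ≡⟨ cong₂ _++_ (A-trivial a a∈ a↦0 i j) (only-constant-power K A-trivial b b∈ b↦0 i j) ⟩
      a j ++ b j    ≡⟨ v≡ab j ⟨
      v j           ∎
      where
      open ≡-Reasoning
      split : ∀ i → ∃₂ λ a b → a ∈ A × b ∈ power K A × v i ≡ a ++ b
      split i = ∈-cartesianProductWith⁻ _++_ A (power K A) (v∈ i)
      a : Fin p → Zpn p n
      a i = proj₁ (split i)
      b : Fin p → Zpn p (K * n)
      b i = proj₁ (proj₂ (split i))
      a∈ : ∀ i → a i ∈ A
      a∈ i = proj₁ (proj₂ (proj₂ (split i)))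
      b∈ : ∀ i → b i ∈ power K A
      b∈ i = proj₁ (proj₂ (proj₂ (proj₂ (split i))))
      v≡ab : ∀ i → v i ≡ a i ++ b i
      v≡ab i = proj₂ (proj₂ (proj₂ (proj₂ (split i))))
      a↦0 : SumsToZero a
      a↦0 = proj₁ (SumsToZero-++ a b v≡ab v↦0)
      b↦0 : SumsToZero b
      b↦0 = proj₂ (SumsToZero-++ a b v≡ab v↦0)

  lookup-injective : ∀ {X : Set} {xs : List X} → Unique xs → ∀ {i j} → List.lookup xs i ≡ List.lookup xs j → i ≡ j
  lookup-injective {xs = _ ∷ _} _                  {zero}  {zero}  _  = refl
  lookup-injective {xs = _ ∷ _} (x∉ AllPairs.∷ _)  {zero}  {suc j} x≡ = ⊥-elim (All.lookup x∉ (∈-lookup j) x≡)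
  lookup-injective {xs = _ ∷ _} (x∉ AllPairs.∷ _)  {suc i} {zero}  ≡x = ⊥-elim (All.lookup x∉ (∈-lookup i) (sym ≡x))
  lookup-injective {xs = _ ∷ _} (_ AllPairs.∷ xs!) {suc i} {suc j} eq = cong suc (lookup-injective xs! eq)

  only-constant-indices : ∀ {p n} {B : List (Zpn p n)} → Unique B → OnlyConstantZeroSums B →
    ∀ (x : Fin p → Fin (length B)) → SumsToZero (λ i → List.lookup B (x i)) → ∀ i j → x i ≡ x j
  only-constant-indices {B = B} B! B-trivial x x↦0 i j =
    lookup-injective B! (B-trivial (λ i → List.lookup B (x i)) (λ i → ∈-lookup (x i)) x↦0 i j)

module Arithmetic where

  open import Data.Nat
  open import Data.Nat.Properties
  open import Data.Nat.Tactic.RingSolver using (solve-∀)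
  open import Relation.Binary.PropositionalEquality

  *-^-distrib : ∀ a b n → (a * b) ^ n ≡ a ^ n * b ^ n
  *-^-distrib a b zero    = refl
  *-^-distrib a b (suc n) = trans (cong (a * b *_) (*-^-distrib a b n)) (interchange a b (a ^ n) (b ^ n))
    where
    interchange : ∀ a b c d → a * b * (c * d) ≡ a * c * (b * d)
    interchange = solve-∀

  bernoulli : ∀ T X → X ^ T * (X + T) ≤ (X + 1) ^ T * X
  bernoulli zero    X = ≤-reflexive (trans (+-identityʳ _) (trans (+-identityʳ X) (sym (+-identityʳ X))))
  bernoulli (suc T) X = begin
    X * X ^ T * (X + suc T)           ≡⟨ expand X (X ^ T) T ⟩
    X ^ T * (X * X + X * T + X)       ≤⟨ *-monoʳ-≤ (X ^ T) (m≤m+n (X * X + X * T + X) T) ⟩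
    X ^ T * (X * X + X * T + X + T)   ≡⟨ factorise X (X ^ T) T ⟩
    (X + 1) * (X ^ T * (X + T))       ≤⟨ *-monoʳ-≤ (X + 1) (bernoulli T X) ⟩
    (X + 1) * ((X + 1) ^ T * X)       ≡⟨ *-assoc (X + 1) _ X ⟨
    (X + 1) ^ suc T * X               ∎
    where
    open ≤-Reasoning
    expand : ∀ X XT T → X * XT * (X + suc T) ≡ XT * (X * X + X * T + X)
    expand = solve-∀
    factorise : ∀ X XT T → XT * (X * X + X * T + X + T) ≡ (X + 1) * (XT * (X + T))
    factorise = solve-∀

  -- With T = c X + 1, Bernoulli's inequality makes ((X + 1) / X) ^ T exceed c.
  pow-gap : ∀ c {X Y} → X < Y → c * X ^ (c * X + 1) < Y ^ (c * X + 1)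
  pow-gap c {zero} {Y@(suc _)} _ = begin-strict
    c * 0 ^ (c * 0 + 1)   ≡⟨ cong (λ e → c * 0 ^ (e + 1)) (*-zeroʳ c) ⟩
    c * 0                 ≡⟨ *-zeroʳ c ⟩
    0                     <⟨ m^n>0 Y (c * 0 + 1) ⟩
    Y ^ (c * 0 + 1)       ∎
    where open ≤-Reasoning
  pow-gap c {X@(suc _)} {Y} X<Y = ≰⇒> λ Yᵀ≤cXᵀ → <-irrefl refl (begin-strict
    X + c * X             <⟨ +-monoʳ-< X (m<m+n (c * X) z<s) ⟩
    X + (c * X + 1)       ≤⟨ *-cancelˡ-≤ (X ^ T) {{m^n≢0 X T}} (begin
      X ^ T * (X + T)       ≤⟨ bernoulli T X ⟩
      (X + 1) ^ T * X       ≤⟨ *-monoˡ-≤ X (^-monoˡ-≤ T (≤-trans (≤-reflexive (+-comm X 1)) X<Y)) ⟩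
      Y ^ T * X             ≤⟨ *-monoˡ-≤ X Yᵀ≤cXᵀ ⟩
      c * X ^ T * X         ≡⟨ rearrange c (X ^ T) X ⟩
      X ^ T * (c * X)       ∎) ⟩
    c * X                 ≤⟨ m≤n+m (c * X) X ⟩
    X + c * X             ∎)
    where
    open ≤-Reasoning
    T : ℕ
    T = c * X + 1
    rearrange : ∀ c a b → c * a * b ≡ a * (c * b)
    rearrange = solve-∀

  tensor-power-trick : ∀ c X Y → (∀ T → 1 ≤ T → Y ^ T ≤ c * X ^ T) → Y ≤ X
  tensor-power-trick c X Y bound = ≮⇒≥ λ X<Y →
    <⇒≱ (pow-gap c X<Y) (bound (c * X + 1) (m≤n+m 1 (c * X)))

  cancel-scale : ∀ A c u v W → 1 ≤ W →
    A * ((u * W) ^ (u * W) * (v * W) ^ (v * W)) ≤ c * (u * W + v * W) ^ (u * W + v * W) →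
    A * (u ^ (u * W) * v ^ (v * W)) ≤ c * (u + v) ^ (u * W + v * W)
  cancel-scale A c u v W W≥1 scaled = *-cancelʳ-≤ _ _ (W ^ E) {{m^n≢0 W E {{>-nonZero W≥1}}}} (begin
    A * (u ^ a * v ^ b) * W ^ E              ≡⟨ cong (A * (u ^ a * v ^ b) *_) (^-distribˡ-+-* W a b) ⟩
    A * (u ^ a * v ^ b) * (W ^ a * W ^ b)    ≡⟨ regroup A (u ^ a) (v ^ b) (W ^ a) (W ^ b) ⟩
    A * ((u ^ a * W ^ a) * (v ^ b * W ^ b))  ≡⟨ cong₂ (λ x y → A * (x * y)) (*-^-distrib u W a) (*-^-distrib v W b) ⟨
    A * ((u * W) ^ a * (v * W) ^ b)          ≤⟨ scaled ⟩
    c * (u * W + v * W) ^ E                  ≡⟨ cong (λ x → c * x ^ E) (*-distribʳ-+ W u v) ⟨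
    c * ((u + v) * W) ^ E                    ≡⟨ cong (c *_) (*-^-distrib (u + v) W E) ⟩
    c * ((u + v) ^ E * W ^ E)                ≡⟨ *-assoc c _ _ ⟨
    c * (u + v) ^ E * W ^ E                  ∎)
    where
    open ≤-Reasoning
    a b E : ℕ
    a = u * W
    b = v * W
    E = a + b
    regroup : ∀ A U V Wa Wb → A * (U * V) * (Wa * Wb) ≡ A * ((U * Wa) * (V * Wb))
    regroup = solve-∀

  ^-*-distrib-³ : ∀ a b c x y z T → (a ^ x * b ^ y * c ^ z) ^ T ≡ a ^ (x * T) * (b ^ (y * T) * c ^ (z * T))
  ^-*-distrib-³ a b c x y z T = begin
    (a ^ x * b ^ y * c ^ z) ^ T                   ≡⟨ *-^-distrib (a ^ x * b ^ y) (c ^ z) T ⟩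
    (a ^ x * b ^ y) ^ T * (c ^ z) ^ T             ≡⟨ cong (_* (c ^ z) ^ T) (*-^-distrib (a ^ x) (b ^ y) T) ⟩
    (a ^ x) ^ T * (b ^ y) ^ T * (c ^ z) ^ T       ≡⟨ *-assoc ((a ^ x) ^ T) _ _ ⟩
    (a ^ x) ^ T * ((b ^ y) ^ T * (c ^ z) ^ T)     ≡⟨ cong₂ (λ s t → s * (t * (c ^ z) ^ T)) (^-*-assoc a x T) (^-*-assoc b y T) ⟩
    a ^ (x * T) * (b ^ (y * T) * (c ^ z) ^ T)     ≡⟨ cong (λ t → a ^ (x * T) * (b ^ (y * T) * t)) (^-*-assoc c z T) ⟩
    a ^ (x * T) * (b ^ (y * T) * c ^ (z * T))     ∎
    where open ≡-Reasoning

open import Data.Empty using (⊥-elim)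
import Data.List as List
open import Data.Nat using (suc; _+_; _*_; _^_; _∸_)
open import Data.Nat.Primality using (¬prime[0]; ¬prime[1])
open import Data.Nat.Properties
open import Data.Nat.Tactic.RingSolver using (solve-∀)
open import Data.Sum using (inj₁; inj₂)
open import Relation.Binary.PropositionalEquality using (_≡_; sym; trans; cong; cong₂; subst)
open import Relation.Nullary using (contradiction)
open Arithmetic
open Monomials using (exponents; length-exponents)
open ZeroSums

module _ {k n : ℕ} (prime : Prime (2 + k)) {A : List (Zpn (2 + k) n)}
         (A! : Unique A) (A-trivial : OnlyConstantZeroSums A) where

  private
    p q : ℕ
    p = 2 + k
    q = suc k

  scaled-power-bound : ∀ T → 1 ≤ T * n →
    length A ^ (p * T) * (q ^ (q * (T * n)) * p ^ (p * (T * n))) ≤ p * (q + p) ^ (q * (T * n) + p * (T * n))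
  scaled-power-bound T W≥1 = cancel-scale (length A ^ (p * T)) p q p W W≥1 (begin
    length A ^ (p * T) * (D ^ D * (p * W) ^ (p * W))       ≡⟨ cong₂ (λ N e → N * (D ^ D * e ^ e)) (length-power (p * T) A) m≡p*W ⟨
    length B * (D ^ D * m ^ m)                             ≤⟨ *-monoˡ-≤ (D ^ D * m ^ m) (Polynomial.size-bound D (≤-reflexive m*q≡p*D)) ⟩
    p * length (exponents m D) * (D ^ D * m ^ m)           ≡⟨ *-assoc p (length (exponents m D)) (D ^ D * m ^ m) ⟩
    p * (length (exponents m D) * (D ^ D * m ^ m))         ≤⟨ *-monoʳ-≤ p (length-exponents m D D m) ⟩
    p * (D + m) ^ (m + D)                                  ≡⟨ cong₂ (λ e f → p * (D + e) ^ f) m≡p*W (trans (+-comm m D) (cong (D +_) m≡p*W)) ⟩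
    p * (D + p * W) ^ (D + p * W)                          ∎)
    where
    open ≤-Reasoning
    W m D : ℕ
    W = T * n
    m = p * T * n
    D = q * W
    B : List (Zpn p m)
    B = power (p * T) A
    m≡p*W : m ≡ p * W
    m≡p*W = *-assoc p T n
    m*q≡p*D : m * q ≡ p * D
    m*q≡p*D = rearrange p T n q
      where
      rearrange : ∀ p T n q → p * T * n * q ≡ p * (q * (T * n))
      rearrange = solve-∀
    module Polynomial = ZeroSumPolynomial k prime (List.lookup B)
                          (only-constant-indices (unique-power (p * T) A!) (only-constant-power (p * T) A-trivial))

  power-bound : ∀ T → 1 ≤ T * n →
    (length A ^ p * q ^ (q * n) * p ^ (p * n)) ^ T ≤ p * ((q + p) ^ ((q + p) * n)) ^ T
  power-bound T W≥1 = begin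
    (length A ^ p * q ^ (q * n) * p ^ (p * n)) ^ T
      ≡⟨ ^-*-distrib-³ (length A) q p p (q * n) (p * n) T ⟩
    length A ^ (p * T) * (q ^ (q * n * T) * p ^ (p * n * T))
      ≡⟨ cong₂ (λ e f → length A ^ (p * T) * (q ^ e * p ^ f)) (reorder q n T) (reorder p n T) ⟩
    length A ^ (p * T) * (q ^ (q * (T * n)) * p ^ (p * (T * n)))
      ≤⟨ scaled-power-bound T W≥1 ⟩
    p * (q + p) ^ (q * (T * n) + p * (T * n))
      ≡⟨ cong (λ e → p * (q + p) ^ e) (collect q p n T) ⟩
    p * (q + p) ^ ((q + p) * n * T)
      ≡⟨ cong (p *_) (^-*-assoc (q + p) ((q + p) * n) T) ⟨
    p * ((q + p) ^ ((q + p) * n)) ^ T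
      ∎
    where
    open ≤-Reasoning
    reorder : ∀ a n T → a * n * T ≡ a * (T * n)
    reorder = solve-∀
    collect : ∀ q p n T → q * (T * n) + p * (T * n) ≡ (q + p) * n * T
    collect = solve-∀

mainTheorem9 : (p n : ℕ) → Prime p → 1 ≤ n →
    (A : List (Zpn p n)) → Unique A → LargeEnough p n (length A) →
    Σ (Fin p → Zpn p n) (λ v →
      ((i : Fin p) → v i ∈ A) ×
      (∃ λ i → ∃ λ j → v i ≢ v j) ×
      SumsToZero v)
mainTheorem9 0 _ p-prime = ⊥-elim (¬prime[0] p-prime)
mainTheorem9 1 _ p-prime = ⊥-elim (¬prime[1] p-prime)
mainTheorem9 p@(suc q@(suc k)) n p-prime n≥1 A A! large with nontrivial-zero-sum? A
... | inj₁ solution  = solution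
... | inj₂ A-trivial = contradiction large (≤⇒≯ (tensor-power-trick p X Y λ T T≥1 →
  subst (λ s → Y ^ T ≤ p * (s ^ (s * n)) ^ T) (sym 2p∸1≡q+p) (power-bound p-prime A! A-trivial T (*-mono-≤ T≥1 n≥1))))
  where
  X Y : ℕ
  X = (2 * p ∸ 1) ^ ((2 * p ∸ 1) * n)
  Y = length A ^ p * q ^ (q * n) * p ^ (p * n)
  2p∸1≡q+p : 2 * p ∸ 1 ≡ q + p
  2p∸1≡q+p = cong (q +_) (+-identityʳ p)
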